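{- Let $\mathcal{C}$ be a circle representation for a graph $G$ such that $\psi_r(\mathcal{C}) = \psi(G) = k$. Then $\mathcal{C}$ contains an independent set in series of size $k-1$. Furthermore, a set of $k$ corners $\tau_0, \ldots, \tau_{k-1}$ (in clockwise order) can be added to $\mathcal{C}$ such that all chords of $\mathcal{C}$ are satisfied and, letting $c_i$ denote the chord whose endpoint on side $s_i$ is close to $\tau_i$ for each $0 \le i \le k-1$: (1) $c_i$ is in $\tau_i$ for all $1 \le i \le k-1$; and (2) one of the following holds: (a) $c_0$ is in $\tau_0$ and $c_0, \ldots, c_{k-1}$ form a $k$-independent set in series; or (b) $c_1, \ldots, c_{k-1}$ form a $(k-1)$-independent set in series, and if $k>2$ then every chord in $\tau_0$ intersects $c_1$ and does not intersect $c_{k-1}$, while if $k=2$ then $G$ is a clique.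
   Context: A circle representation of a graph $G$ is a set of chords of a circle, one per vertex, with all endpoints distinct, such that two vertices are adjacent iff their chords intersect. Corners are points of the circle distinct from chord endpoints; a chord is satisfied by a set of corners if each of the two open arcs determined by its endpoints contains a corner. $\psi_r(\mathcal{C})$ is the minimum number of corners that must be added to $\mathcal{C}$ to satisfy all its chords. A circle representation with $k$ satisfying corners is a $k$-polygon representation ($k\ge 2$; for $k=2$ a permutation representation); $\psi(G)$ is the minimum $k\ge2$ such that $G$ has a $k$-polygon representation. Given corners $\tau_0,\dots,\tau_{k-1}$ in clockwise order, side $s_i$ is the open arc from $\tau_i$ clockwise to $\tau_{i+1}$ (indices mod $k$), so $s_{i-1}$ and $s_i$ meet at $\tau_i$. A chord is in corner $\tau_i$ if its endpoints lie on the two sides $s_{i-1}$ and $s_i$ (for $k=2$ every chord is in both corners). A chord endpoint $e$ lying on a side meeting at $\tau$ is close to $\tau$ if no other chord endpoint on that side lies between $\tau$ and $e$. A sequence $c_0, \ldots, c_{\ell-1}$ of $\ell \ge 1$ chords is an $\ell$-independent set in series (an independent set in series of size $\ell$) if there is a point $x$ on the circle such that, in a clockwise traversal of the circle starting at $x$ and ending just before returning to $x$, both endpoints of $c_i$ are encountered before both endpoints of $c_{i+1}$ for all $0 \le i < \ell-1$.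
   Formalization: Points of the circle are taken in the rationals, closed up at a point no chord or corner uses, so chord endpoints, corners and the representations defining $\psi(G)$ are rational. -}

module Defs where

open import Data.Nat using (ℕ; zero; suc; _∸_) renaming (_<_ to _<ℕ_; _≤_ to _≤ℕ_)
open import Data.Nat.Properties using () renaming (_≟_ to _≟ℕ_)
open import Data.Fin using (Fin)
open import Data.Rational using (ℚ; _<_; _≤_)
open import Data.Product using (Σ; ∃; _×_; _,_)
open import Data.Sum using (_⊎_)
open import Data.List using (List; length)
open import Data.List.Relation.Unary.Linked using (Linked)
open import Data.Empty using (⊥)
open import Relation.Nullary using (¬_; yes; no)
open import Relation.Binary.PropositionalEquality using (_≡_; _≢_)
open import Function.Definitions using (Injective)
open import Function.Bundles using (_⇔_)

-- Points of the circle are modelled by rationals; the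
-- clockwise direction is the increasing direction and the circle is
-- closed up "at infinity" (a point never used by any chord or corner).
-- Every finite configuration of points on a circle is realised this way
-- (up to cyclic-order isomorphism), and ℚ is dense so corners can always
-- be inserted between endpoints.

Point : Set
Point = ℚ

-- cwLt x p q : starting a clockwise traversal at x (x itself is visited
-- first) and ending just before returning to x, p is encountered
-- strictly before q.
cwLt : Point → Point → Point → Set
cwLt x p q = (x ≤ p × x ≤ q × p < q)
           ⊎ (x ≤ p × q < x)
           ⊎ (p < x × q < x × p < q)

Arc : Point → Point → Point → Set
Arc a b p = cwLt a a p × cwLt a p b

-- The two open arcs determined by two distinct points a, b.
Between : Point → Point → Point → Set
Between a b p = (a < p × p < b) ⊎ (b < p × p < a)

Outside : Point → Point → Point → Set
Outside a b p = (p < a × p < b) ⊎ (a < p × b < p)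

record CircleRep (n : ℕ) : Set where
  field
    l     : Fin n → Point
    r     : Fin n → Point
    l-inj : Injective _≡_ _≡_ l
    r-inj : Injective _≡_ _≡_ r
    l≢r   : ∀ u v → l u ≢ r v
open CircleRep public

module _ {n : ℕ} (C : CircleRep n) where

  IsEndpoint : Point → Set
  IsEndpoint p = ∃ λ v → (p ≡ l C v) ⊎ (p ≡ r C v)

  -- chords u and v intersect (adjacency in the represented graph)
  Cross : Fin n → Fin n → Set
  Cross u v = (Between (l C u) (r C u) (l C v) × Outside (l C u) (r C u) (r C v))
            ⊎ (Outside (l C u) (r C u) (l C v) × Between (l C u) (r C u) (r C v))

  Clique : Set
  Clique = ∀ u v → u ≢ v → Cross u v

  IsCorner : Point → Set
  IsCorner p = ¬ IsEndpoint p

  Satisfied : (Point → Set) → Fin n → Set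
  Satisfied S v = (∃ λ p → S p × Between (l C v) (r C v) p)
                × (∃ λ p → S p × Outside (l C v) (r C v) p)

  SatisfiedBy : ℕ → Set
  SatisfiedBy m = Σ (Fin m → Point) λ τ →
      Injective _≡_ _≡_ τ × (∀ i → IsCorner (τ i))
    × (∀ v → Satisfied (λ p → ∃ λ i → τ i ≡ p) v)

  PsiR : ℕ → Set
  PsiR k = SatisfiedBy k × (∀ m → m <ℕ k → ¬ SatisfiedBy m)

  BothBefore : Point → Fin n → Fin n → Set
  BothBefore x u v = cwLt x (l C u) (l C v) × cwLt x (l C u) (r C v)
                   × cwLt x (r C u) (l C v) × cwLt x (r C u) (r C v)

  IndepSeries : List (Fin n) → Set
  IndepSeries L = (1 ≤ℕ length L) × ∃ λ x → Linked (BothBefore x) L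

SameGraph : ∀ {n} → CircleRep n → CircleRep n → Set
SameGraph C C' = ∀ u v → Cross C u v ⇔ Cross C' u v

HasPolygonRep : ∀ {n} → CircleRep n → ℕ → Set
HasPolygonRep {n} C m = Σ (CircleRep n) λ C' → SameGraph C C' × SatisfiedBy C' m

Psi : ∀ {n} → CircleRep n → ℕ → Set
Psi C k = 2 ≤ℕ k × HasPolygonRep C k
        × (∀ m → 2 ≤ℕ m → m <ℕ k → ¬ HasPolygonRep C m)

-- Labelled corners τ 0, …, τ (k-1) (a ℕ-indexed family; only indices
-- < k matter).  Index arithmetic mod k:

nextIdx : ℕ → ℕ → ℕ
nextIdx k i with suc i ≟ℕ k
... | yes _ = 0
... | no  _ = suc i

prevIdx : ℕ → ℕ → ℕ
prevIdx k zero    = k ∸ 1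
prevIdx k (suc i) = i

module _ {n : ℕ} (C : CircleRep n) (k : ℕ) (τ : ℕ → Point) where

  GoodCorners : Set
  GoodCorners = (∀ i → i <ℕ k → IsCorner C (τ i))
              × (∀ i j → i <ℕ j → j <ℕ k → cwLt (τ 0) (τ i) (τ j))
              × (∀ v → Satisfied C (λ p → ∃ λ i → i <ℕ k × τ i ≡ p) v)

  OnSide : ℕ → Point → Set
  OnSide i p = Arc (τ i) (τ (nextIdx k i)) p

  InCorner : ℕ → Fin n → Set
  InCorner i v = (OnSide (prevIdx k i) (l C v) × OnSide i (r C v))
               ⊎ (OnSide (prevIdx k i) (r C v) × OnSide i (l C v))

  CloseChord : ℕ → Fin n → Set
  CloseChord i v = ∃ λ e → ((e ≡ l C v) ⊎ (e ≡ r C v)) × OnSide i e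
                 × (∀ u → ¬ Arc (τ i) e (l C u) × ¬ Arc (τ i) e (r C u))

-- Cut the circle open at one corner x of a minimum satisfying set of k corners and pick
-- endpoints greedily: F 0 is the first endpoint after x, and F (i + 1) the first endpoint
-- closing a chord that opens at or after F i.  Inside each chord so closed lies a corner of
-- the minimum set, and these corners together with x increase strictly, so the chain has at
-- most k points.  Conversely, corners placed just before the F i satisfy every chord, since a
-- chord with both ends between consecutive F's would contradict greediness; by minimality the
-- chain has exactly k points.  The chords closed at F 1, ..., F (k - 1) follow one another, an
-- independent set in series, and each lies in its corner.  If some chord in corner τ 0
-- encloses the chord of F 1 (for k = 2: if two chords do not cross), moving τ 0 in front of
-- the first such chord gives alternative (a); otherwise alternative (b) holds as it stands.

module Submission where

open import Defs
open import Data.Bool using (Bool; true; false; not)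
open import Data.Empty using (⊥-elim)
open import Data.Fin using (Fin; zero; suc; toℕ; fromℕ<)
open import Data.Fin.Properties using (toℕ-injective; toℕ<n; toℕ-fromℕ<; pigeonhole)
import Data.Fin.Properties as Fin
open import Data.List using (List; []; _∷_; map; upTo; applyUpTo; length; allFin; _++_)
open import Data.List.Properties using (map-upTo; length-map; length-upTo)
open import Data.List.Membership.Propositional using (_∈_)
open import Data.List.Membership.Propositional.Properties using (∈-map⁺; ∈-++⁺ˡ; ∈-++⁺ʳ; ∈-allFin)
open import Data.List.Relation.Unary.Any using (here; there)
open import Data.List.Relation.Unary.Linked using (Linked; []; [-]; _∷_)
open import Data.Nat using (ℕ; zero; suc; _∸_; z≤n; s≤s) renaming (_<_ to _<ℕ_; _≤_ to _≤ℕ_)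
import Data.Nat.Properties as ℕ
open import Data.Product using (Σ; ∃; _×_; _,_; proj₁; proj₂)
open import Data.Rational using (ℚ; _<_; _≤_; _-_; 1ℚ; 0ℚ; -_; _<?_)
open import Data.Rational.Properties
  using (<-isStrictTotalOrder; <-trans; <-irrefl; <-cmp; ≤-<-trans; <-≤-trans; <⇒≤; ≤-refl; ≤-reflexive;
         <-dense; +-identityʳ; +-monoʳ-<)
open import Data.Sum using (_⊎_; inj₁; inj₂)
open import Data.Unit using (⊤; tt)
open import Function using (_∘_)
open import Relation.Binary.Definitions using (Tri; tri<; tri≈; tri>)
open import Relation.Binary.PropositionalEquality using (_≡_; _≢_; refl; sym; trans; subst; cong; resp₂; isEquivalence)
open import Relation.Binary.Structures using (IsStrictTotalOrder)
open import Relation.Nullary using (¬_; Dec; yes; no)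
open import Relation.Nullary.Decidable using (toWitness; ¬?; _×-dec_; _⊎-dec_)

linked-map-upTo : ∀ {A : Set} {R : A → A → Set} (f : ℕ → A) m →
                  (∀ i → suc i <ℕ m → R (f i) (f (suc i))) → Linked R (map f (upTo m))
linked-map-upTo {R = R} f m step = subst (Linked R) (sym (map-upTo f m)) (linked-applyUpTo f m step)
  where
  linked-applyUpTo : ∀ (f : ℕ → _) m → (∀ i → suc i <ℕ m → R (f i) (f (suc i))) → Linked R (applyUpTo f m)
  linked-applyUpTo f zero step = []
  linked-applyUpTo f (suc zero) step = [-]
  linked-applyUpTo f (suc (suc m)) step =
    step 0 (s≤s (s≤s z≤n)) ∷ linked-applyUpTo (f ∘ suc) (suc m) (λ i lt → step (suc i) (s≤s lt))

length-map-upTo : ∀ {A : Set} (f : ℕ → A) m → length (map f (upTo m)) ≡ m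
length-map-upTo f m = trans (length-map f (upTo m)) (length-upTo m)

nextIdx-< : ∀ {m i} → i <ℕ m → nextIdx (suc m) i ≡ suc i
nextIdx-< {m} {i} i<m with suc i ℕ.≟ suc m
... | yes eq = ⊥-elim (ℕ.<-irrefl (ℕ.suc-injective eq) i<m)
... | no _ = refl

nextIdx-last : ∀ m → nextIdx (suc m) m ≡ 0
nextIdx-last m with suc m ℕ.≟ suc m
... | yes _ = refl
... | no m≢m = ⊥-elim (m≢m refl)

Between? : ∀ a b p → Dec (Between a b p)
Between? a b p = ((a <? p) ×-dec (p <? b)) ⊎-dec ((b <? p) ×-dec (p <? a))

Outside? : ∀ a b p → Dec (Outside a b p)
Outside? a b p = ((p <? a) ×-dec (p <? b)) ⊎-dec ((a <? p) ×-dec (b <? p))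

Cross? : ∀ {n} (C : CircleRep n) u v → Dec (Cross C u v)
Cross? C u v = (Between? (l C u) (r C u) (l C v) ×-dec Outside? (l C u) (r C u) (r C v))
        ⊎-dec (Outside? (l C u) (r C u) (l C v) ×-dec Between? (l C u) (r C u) (r C v))

module CyclicOrder {A : Set} {_⊏_ : A → A → Set} (isSTO : IsStrictTotalOrder _≡_ _⊏_) where

  open IsStrictTotalOrder isSTO public
    using () renaming (trans to ⊏-trans; compare to ⊏-compare; asym to ⊏-asym; _<?_ to _⊏?_)

  ⊏-irrefl : ∀ {a} → ¬ (a ⊏ a)
  ⊏-irrefl = IsStrictTotalOrder.irrefl isSTO refl

  ⊏⇒≢ : ∀ {a b} → a ⊏ b → a ≢ b
  ⊏⇒≢ p refl = ⊏-irrefl p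

  _⊑_ : A → A → Set
  a ⊑ b = (a ≡ b) ⊎ (a ⊏ b)

  ⊑-refl : ∀ {a} → a ⊑ a
  ⊑-refl = inj₁ refl

  ⊑-⊏-trans : ∀ {a b c} → a ⊑ b → b ⊏ c → a ⊏ c
  ⊑-⊏-trans (inj₁ refl) q = q
  ⊑-⊏-trans (inj₂ p) q = ⊏-trans p q

  ⊏-⊑-trans : ∀ {a b c} → a ⊏ b → b ⊑ c → a ⊏ c
  ⊏-⊑-trans p (inj₁ refl) = p
  ⊏-⊑-trans p (inj₂ q) = ⊏-trans p q

  ⊑-trans : ∀ {a b c} → a ⊑ b → b ⊑ c → a ⊑ c
  ⊑-trans (inj₁ refl) q = q
  ⊑-trans (inj₂ p) q = inj₂ (⊏-⊑-trans p q)

  ⊑⇒⊐̸ : ∀ {a b} → a ⊑ b → ¬ (b ⊏ a)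
  ⊑⇒⊐̸ (inj₁ refl) q = ⊏-irrefl q
  ⊑⇒⊐̸ (inj₂ p) q = ⊏-asym p q

  ⊐̸⇒⊑ : ∀ {a b} → ¬ (b ⊏ a) → a ⊑ b
  ⊐̸⇒⊑ {a} {b} b⊐̸a with ⊏-compare a b
  ... | tri< a⊏b _ _ = inj₂ a⊏b
  ... | tri≈ _ a≡b _ = inj₁ a≡b
  ... | tri> _ _ b⊏a = ⊥-elim (b⊐̸a b⊏a)

  ⋢⇒⊐ : ∀ {a b} → ¬ (a ⊑ b) → b ⊏ a
  ⋢⇒⊐ {a} {b} a⋢b with ⊏-compare a b
  ... | tri< a⊏b _ _ = ⊥-elim (a⋢b (inj₂ a⊏b))
  ... | tri≈ _ a≡b _ = ⊥-elim (a⋢b (inj₁ a≡b))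
  ... | tri> _ _ b⊏a = b⊏a

  _⊑?_ : ∀ a b → Dec (a ⊑ b)
  a ⊑? b with ⊏-compare a b
  ... | tri< a⊏b _ _ = yes (inj₂ a⊏b)
  ... | tri≈ _ a≡b _ = yes (inj₁ a≡b)
  ... | tri> _ _ b⊏a = no (λ a⊑b → ⊑⇒⊐̸ a⊑b b⊏a)

  Cyclic : A → A → A → Set
  Cyclic a b c = (a ⊏ b × b ⊏ c) ⊎ (b ⊏ c × c ⊏ a) ⊎ (c ⊏ a × a ⊏ b)

  Cyclic-rotate : ∀ {a b c} → Cyclic a b c → Cyclic b c a
  Cyclic-rotate (inj₁ (p , q)) = inj₂ (inj₂ (p , q))
  Cyclic-rotate (inj₂ (inj₁ (p , q))) = inj₁ (p , q)
  Cyclic-rotate (inj₂ (inj₂ (p , q))) = inj₂ (inj₁ (p , q))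

  Cyclic-asym : ∀ {a b c} → Cyclic a b c → ¬ Cyclic c b a
  Cyclic-asym (inj₁ (p , q)) (inj₁ (r , s)) = ⊏-asym p s
  Cyclic-asym (inj₁ (p , q)) (inj₂ (inj₁ (r , s))) = ⊏-asym p r
  Cyclic-asym (inj₁ (p , q)) (inj₂ (inj₂ (r , s))) = ⊏-asym q s
  Cyclic-asym (inj₂ (inj₁ (p , q))) (inj₁ (r , s)) = ⊏-asym p r
  Cyclic-asym (inj₂ (inj₁ (p , q))) (inj₂ (inj₁ (r , s))) = ⊏-asym q s
  Cyclic-asym (inj₂ (inj₁ (p , q))) (inj₂ (inj₂ (r , s))) = ⊏-asym p s
  Cyclic-asym (inj₂ (inj₂ (p , q))) (inj₁ (r , s)) = ⊏-asym q s
  Cyclic-asym (inj₂ (inj₂ (p , q))) (inj₂ (inj₁ (r , s))) = ⊏-asym q r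
  Cyclic-asym (inj₂ (inj₂ (p , q))) (inj₂ (inj₂ (r , s))) = ⊏-asym p r

  -- The order of a traversal starting at y, as cwLt in Defs.
  Rebased : A → A → A → Set
  Rebased y p q = (y ⊑ p × p ⊏ q) ⊎ (q ⊏ y × y ⊑ p) ⊎ (p ⊏ q × q ⊏ y)

  -- Rebased y expressed through the cyclic order alone, which makes it
  -- independent of the linear order the cyclic order comes from.
  CyclicallyBefore : A → A → A → Set
  CyclicallyBefore y p q = (y ≡ p × p ≢ q) ⊎ Cyclic y p q

  rebased⇒cyclicallyBefore : ∀ {y p q} → Rebased y p q → CyclicallyBefore y p q
  rebased⇒cyclicallyBefore (inj₁ (inj₁ refl , pq)) = inj₁ (refl , ⊏⇒≢ pq)
  rebased⇒cyclicallyBefore (inj₁ (inj₂ yp , pq)) = inj₂ (inj₁ (yp , pq))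
  rebased⇒cyclicallyBefore (inj₂ (inj₁ (qy , inj₁ refl))) = inj₁ (refl , λ e → ⊏⇒≢ qy (sym e))
  rebased⇒cyclicallyBefore (inj₂ (inj₁ (qy , inj₂ yp))) = inj₂ (inj₂ (inj₂ (qy , yp)))
  rebased⇒cyclicallyBefore (inj₂ (inj₂ (pq , qy))) = inj₂ (inj₂ (inj₁ (pq , qy)))

  cyclicallyBefore⇒rebased : ∀ {y p q} → CyclicallyBefore y p q → Rebased y p q
  cyclicallyBefore⇒rebased {y} {q = q} (inj₁ (refl , p≢q)) with ⊏-compare y q
  ... | tri< y⊏q _ _ = inj₁ (⊑-refl , y⊏q)
  ... | tri≈ _ y≡q _ = ⊥-elim (p≢q y≡q)
  ... | tri> _ _ q⊏y = inj₂ (inj₁ (q⊏y , ⊑-refl))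
  cyclicallyBefore⇒rebased (inj₂ (inj₁ (yp , pq))) = inj₁ (inj₂ yp , pq)
  cyclicallyBefore⇒rebased (inj₂ (inj₂ (inj₁ (pq , qy)))) = inj₂ (inj₂ (pq , qy))
  cyclicallyBefore⇒rebased (inj₂ (inj₂ (inj₂ (qy , yp)))) = inj₂ (inj₁ (qy , inj₂ yp))

  Inner : A → A → A → Set
  Inner a b p = (a ⊏ p × p ⊏ b) ⊎ (b ⊏ p × p ⊏ a)

  Outer : A → A → A → Set
  Outer a b p = (p ⊏ a × p ⊏ b) ⊎ (a ⊏ p × b ⊏ p)

  Crossing : A → A → A → A → Set
  Crossing a b c d = (Inner a b c × Outer a b d) ⊎ (Outer a b c × Inner a b d)

  CrossingCyclic : A → A → A → A → Set
  CrossingCyclic a b c d = (Cyclic a c b × Cyclic b d a) ⊎ (Cyclic b c a × Cyclic a d b)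

  Inner-sym : ∀ {a b p} → Inner a b p → Inner b a p
  Inner-sym (inj₁ x) = inj₂ x
  Inner-sym (inj₂ x) = inj₁ x

  Outer-sym : ∀ {a b p} → Outer a b p → Outer b a p
  Outer-sym (inj₁ (x , y)) = inj₁ (y , x)
  Outer-sym (inj₂ (x , y)) = inj₂ (y , x)

  private
    inner⇒cyclic : ∀ {a b p} → a ⊏ b → Inner a b p → Cyclic a p b
    inner⇒cyclic ab (inj₁ (x , y)) = inj₁ (x , y)
    inner⇒cyclic ab (inj₂ (x , y)) = ⊥-elim (⊏-asym ab (⊏-trans x y))

    cyclic⇒inner : ∀ {a b p} → a ⊏ b → Cyclic a p b → Inner a b p
    cyclic⇒inner ab (inj₁ (x , y)) = inj₁ (x , y)
    cyclic⇒inner ab (inj₂ (inj₁ (x , y))) = ⊥-elim (⊏-asym ab y)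
    cyclic⇒inner ab (inj₂ (inj₂ (x , y))) = ⊥-elim (⊏-asym ab x)

    outer⇒cyclic : ∀ {a b p} → a ⊏ b → Outer a b p → Cyclic b p a
    outer⇒cyclic ab (inj₁ (x , y)) = inj₂ (inj₁ (x , ab))
    outer⇒cyclic ab (inj₂ (x , y)) = inj₂ (inj₂ (ab , y))

    cyclic⇒outer : ∀ {a b p} → a ⊏ b → Cyclic b p a → Outer a b p
    cyclic⇒outer ab (inj₁ (x , y)) = ⊥-elim (⊏-asym ab (⊏-trans x y))
    cyclic⇒outer ab (inj₂ (inj₁ (x , y))) = inj₁ (x , ⊏-trans x y)
    cyclic⇒outer ab (inj₂ (inj₂ (x , y))) = inj₂ (⊏-trans x y , y)

    Inner-irrefl : ∀ {a p} → ¬ Inner a a p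
    Inner-irrefl (inj₁ (x , y)) = ⊏-asym x y
    Inner-irrefl (inj₂ (x , y)) = ⊏-asym x y

  crossing⇒cyclic : ∀ {a b c d} → Crossing a b c d → CrossingCyclic a b c d
  crossing⇒cyclic {a} {b} with ⊏-compare a b
  ... | tri< ab _ _ = λ
    { (inj₁ (x , y)) → inj₁ (inner⇒cyclic ab x , outer⇒cyclic ab y)
    ; (inj₂ (x , y)) → inj₂ (outer⇒cyclic ab x , inner⇒cyclic ab y) }
  ... | tri≈ _ refl _ = λ
    { (inj₁ (x , _)) → ⊥-elim (Inner-irrefl x)
    ; (inj₂ (_ , y)) → ⊥-elim (Inner-irrefl y) }
  ... | tri> _ _ ba = λ
    { (inj₁ (x , y)) → inj₂ (inner⇒cyclic ba (Inner-sym x) , outer⇒cyclic ba (Outer-sym y))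
    ; (inj₂ (x , y)) → inj₁ (outer⇒cyclic ba (Outer-sym x) , inner⇒cyclic ba (Inner-sym y)) }

  cyclic⇒crossing : ∀ {a b c d} → CrossingCyclic a b c d → Crossing a b c d
  cyclic⇒crossing {a} {b} with ⊏-compare a b
  ... | tri< ab _ _ = λ
    { (inj₁ (x , y)) → inj₁ (cyclic⇒inner ab x , cyclic⇒outer ab y)
    ; (inj₂ (x , y)) → inj₂ (cyclic⇒outer ab x , cyclic⇒inner ab y) }
  ... | tri≈ _ refl _ = λ
    { (inj₁ (x , _)) → ⊥-elim (Cyclic-asym x x)
    ; (inj₂ (x , _)) → ⊥-elim (Cyclic-asym x x) }
  ... | tri> _ _ ba = λ
    { (inj₁ (x , y)) → inj₂ (Outer-sym (cyclic⇒outer ba x) , Inner-sym (cyclic⇒inner ba y))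
    ; (inj₂ (x , y)) → inj₁ (Inner-sym (cyclic⇒inner ba x) , Outer-sym (cyclic⇒outer ba y)) }

  SatisfiedBetween : (A → Set) → A → A → Set
  SatisfiedBetween S a b = (∃ λ p → S p × Inner a b p) × (∃ λ p → S p × Outer a b p)

  SatisfiedCyclic : (A → Set) → A → A → Set
  SatisfiedCyclic S a b = (∃ λ p → S p × Cyclic a p b) × (∃ λ p → S p × Cyclic b p a)

  SatisfiedBetween-sym : ∀ {S a b} → SatisfiedBetween S a b → SatisfiedBetween S b a
  SatisfiedBetween-sym ((p , sp , ip) , (q , sq , oq)) = (p , sp , Inner-sym ip) , (q , sq , Outer-sym oq)

  satisfied⇒cyclic : ∀ {S a b} → SatisfiedBetween S a b → SatisfiedCyclic S a b
  satisfied⇒cyclic {a = a} {b} ((p , sp , ip) , (q , sq , oq)) with ⊏-compare a b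
  ... | tri< ab _ _ = (p , sp , inner⇒cyclic ab ip) , (q , sq , outer⇒cyclic ab oq)
  ... | tri≈ _ refl _ = ⊥-elim (Inner-irrefl ip)
  ... | tri> _ _ ba = (q , sq , outer⇒cyclic ba (Outer-sym oq)) , (p , sp , inner⇒cyclic ba (Inner-sym ip))

  cyclic⇒satisfied : ∀ {S a b} → SatisfiedCyclic S a b → SatisfiedBetween S a b
  cyclic⇒satisfied {a = a} {b} ((p , sp , cp) , (q , sq , cq)) with ⊏-compare a b
  ... | tri< ab _ _ = (p , sp , cyclic⇒inner ab cp) , (q , sq , cyclic⇒outer ab cq)
  ... | tri≈ _ refl _ = ⊥-elim (Cyclic-asym cp cp)
  ... | tri> _ _ ba = (q , sq , Inner-sym (cyclic⇒inner ba cq)) , (p , sp , Outer-sym (cyclic⇒outer ba cp))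

  argmin : ∀ {I : Set} (key : I → A) (P : I → Set) → (∀ i → Dec (P i)) → (xs : List I) →
           (∀ i → i ∈ xs → ¬ P i) ⊎ (Σ I λ i → P i × (∀ j → j ∈ xs → P j → key i ⊑ key j))
  argmin key P P? [] = inj₁ (λ i ())
  argmin key P P? (y ∷ ys) with P? y | argmin key P P? ys
  ... | no ¬py | inj₁ none = inj₁ λ { i (here refl) → ¬py ; i (there m) → none i m }
  ... | no ¬py | inj₂ (i , pi , least) =
        inj₂ (i , pi , λ { j (here refl) pj → ⊥-elim (¬py pj) ; j (there m) pj → least j m pj })
  ... | yes py | inj₁ none =
        inj₂ (y , py , λ { j (here refl) pj → ⊑-refl ; j (there m) pj → ⊥-elim (none j m pj) })
  ... | yes py | inj₂ (i , pi , least) with key y ⊑? key i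
  ...   | yes y⊑i = inj₂ (y , py , λ { j (here refl) pj → ⊑-refl ; j (there m) pj → ⊑-trans y⊑i (least j m pj) })
  ...   | no y⋢i = inj₂ (i , pi , λ { j (here refl) pj → inj₂ (⋢⇒⊐ y⋢i) ; j (there m) pj → least j m pj })

module RationalCircle where

  module Q< = CyclicOrder <-isStrictTotalOrder

  ≤⇒⊑ : ∀ {a b} → a ≤ b → a Q<.⊑ b
  ≤⇒⊑ {a} {b} a≤b with <-cmp a b
  ... | tri< a<b _ _ = inj₂ a<b
  ... | tri≈ _ a≡b _ = inj₁ a≡b
  ... | tri> _ _ b<a = ⊥-elim (<-irrefl refl (<-≤-trans b<a a≤b))

  ⊑⇒≤ : ∀ {a b} → a Q<.⊑ b → a ≤ b
  ⊑⇒≤ (inj₁ refl) = ≤-refl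
  ⊑⇒≤ (inj₂ a<b) = <⇒≤ a<b

  ≤⊎> : ∀ x p → (x ≤ p) ⊎ (p < x)
  ≤⊎> x p with <-cmp p x
  ... | tri< p<x _ _ = inj₂ p<x
  ... | tri≈ _ p≡x _ = inj₁ (≤-reflexive (sym p≡x))
  ... | tri> _ _ x<p = inj₁ (<⇒≤ x<p)

  module _ (x : ℚ) where

    private
      _≺_ : ℚ → ℚ → Set
      _≺_ = cwLt x

    ≤-≤-<⇒cwLt : ∀ {p q} → x ≤ p → x ≤ q → p < q → p ≺ q
    ≤-≤-<⇒cwLt a b c = inj₁ (a , b , c)

    ≤->⇒cwLt : ∀ {p q} → x ≤ p → q < x → p ≺ q
    ≤->⇒cwLt a b = inj₂ (inj₁ (a , b))

    >->-<⇒cwLt : ∀ {p q} → p < x → q < x → p < q → p ≺ q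
    >->-<⇒cwLt a b c = inj₂ (inj₂ (a , b , c))

    cwLt-trans : ∀ {p q r} → p ≺ q → q ≺ r → p ≺ r
    cwLt-trans (inj₁ (hp , hq , pq)) (inj₁ (_ , hr , qr)) = inj₁ (hp , hr , <-trans pq qr)
    cwLt-trans (inj₁ (hp , hq , pq)) (inj₂ (inj₁ (_ , lr))) = inj₂ (inj₁ (hp , lr))
    cwLt-trans (inj₁ (hp , hq , pq)) (inj₂ (inj₂ (lq , _))) = ⊥-elim (<-irrefl refl (<-≤-trans lq hq))
    cwLt-trans (inj₂ (inj₁ (hp , lq))) (inj₁ (hq , _)) = ⊥-elim (<-irrefl refl (<-≤-trans lq hq))
    cwLt-trans (inj₂ (inj₁ (hp , lq))) (inj₂ (inj₁ (hq , _))) = ⊥-elim (<-irrefl refl (<-≤-trans lq hq))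
    cwLt-trans (inj₂ (inj₁ (hp , lq))) (inj₂ (inj₂ (_ , lr , _))) = inj₂ (inj₁ (hp , lr))
    cwLt-trans (inj₂ (inj₂ (lp , lq , _))) (inj₁ (hq , _)) = ⊥-elim (<-irrefl refl (<-≤-trans lq hq))
    cwLt-trans (inj₂ (inj₂ (lp , lq , _))) (inj₂ (inj₁ (hq , _))) = ⊥-elim (<-irrefl refl (<-≤-trans lq hq))
    cwLt-trans (inj₂ (inj₂ (lp , lq , pq))) (inj₂ (inj₂ (_ , lr , qr))) = inj₂ (inj₂ (lp , lr , <-trans pq qr))

    cwLt-irrefl : ∀ {p} → ¬ (p ≺ p)
    cwLt-irrefl (inj₁ (_ , _ , pp)) = <-irrefl refl pp
    cwLt-irrefl (inj₂ (inj₁ (h , l))) = <-irrefl refl (<-≤-trans l h)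
    cwLt-irrefl (inj₂ (inj₂ (_ , _ , pp))) = <-irrefl refl pp

    private
      lt : ∀ {p q} → p ≺ q → p ≢ q → Tri (p ≺ q) (p ≡ q) (q ≺ p)
      lt pq p≢q = tri< pq p≢q (λ qp → cwLt-irrefl (cwLt-trans pq qp))

      gt : ∀ {p q} → q ≺ p → p ≢ q → Tri (p ≺ q) (p ≡ q) (q ≺ p)
      gt qp p≢q = tri> (λ pq → cwLt-irrefl (cwLt-trans pq qp)) p≢q qp

    cwLt-cmp : ∀ p q → Tri (p ≺ q) (p ≡ q) (q ≺ p)
    cwLt-cmp p q with <-cmp p q | ≤⊎> x p | ≤⊎> x q
    ... | tri≈ _ refl _ | _ | _ = tri≈ cwLt-irrefl refl cwLt-irrefl
    ... | tri< a _ _ | inj₁ hp | inj₁ hq = lt (≤-≤-<⇒cwLt hp hq a) (λ e → <-irrefl e a)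
    ... | tri< a _ _ | inj₁ hp | inj₂ lq = ⊥-elim (<-irrefl refl (<-trans lq (≤-<-trans hp a)))
    ... | tri< a _ _ | inj₂ lp | inj₁ hq = gt (≤->⇒cwLt hq lp) (λ e → <-irrefl e a)
    ... | tri< a _ _ | inj₂ lp | inj₂ lq = lt (>->-<⇒cwLt lp lq a) (λ e → <-irrefl e a)
    ... | tri> _ _ c | inj₁ hp | inj₁ hq = gt (≤-≤-<⇒cwLt hq hp c) (λ e → <-irrefl (sym e) c)
    ... | tri> _ _ c | inj₁ hp | inj₂ lq = lt (≤->⇒cwLt hp lq) (λ e → <-irrefl (sym e) c)
    ... | tri> _ _ c | inj₂ lp | inj₁ hq = ⊥-elim (<-irrefl refl (<-trans lp (≤-<-trans hq c)))
    ... | tri> _ _ c | inj₂ lp | inj₂ lq = gt (>->-<⇒cwLt lq lp c) (λ e → <-irrefl (sym e) c)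

    cwLt-isStrictTotalOrder : IsStrictTotalOrder _≡_ _≺_
    cwLt-isStrictTotalOrder = record
      { isStrictPartialOrder = record
        { isEquivalence = isEquivalence
        ; irrefl = λ { refl → cwLt-irrefl }
        ; trans = cwLt-trans
        ; <-resp-≈ = resp₂ _≺_
        }
      ; compare = cwLt-cmp
      }

    cwLt-least : ∀ {p} → p ≢ x → x ≺ p
    cwLt-least {p} p≢x with ≤⊎> x p
    ... | inj₂ lp = ≤->⇒cwLt ≤-refl lp
    ... | inj₁ hp with <-cmp x p
    ...   | tri< a _ _ = ≤-≤-<⇒cwLt ≤-refl hp a
    ...   | tri≈ _ e _ = ⊥-elim (p≢x (sym e))
    ...   | tri> _ _ c = ⊥-elim (<-irrefl refl (<-≤-trans c hp))

  module Cw (x : ℚ) = CyclicOrder (cwLt-isStrictTotalOrder x)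

  module _ {x : ℚ} where

    private
      <-<⇒cyclicˣ : ∀ {a b c} → a < b → b < c → Cw.Cyclic x a b c
      <-<⇒cyclicˣ {a} {b} {c} ab bc with ≤⊎> x a | ≤⊎> x b | ≤⊎> x c
      ... | inj₁ ha | inj₁ hb | inj₁ hc = inj₁ (≤-≤-<⇒cwLt x ha hb ab , ≤-≤-<⇒cwLt x hb hc bc)
      ... | inj₁ ha | inj₁ hb | inj₂ lc = ⊥-elim (<-irrefl refl (<-trans lc (≤-<-trans hb bc)))
      ... | inj₁ ha | inj₂ lb | _ = ⊥-elim (<-irrefl refl (<-trans lb (≤-<-trans ha ab)))
      ... | inj₂ la | inj₁ hb | inj₁ hc = inj₂ (inj₁ (≤-≤-<⇒cwLt x hb hc bc , ≤->⇒cwLt x hc la))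
      ... | inj₂ la | inj₁ hb | inj₂ lc = ⊥-elim (<-irrefl refl (<-trans lc (≤-<-trans hb bc)))
      ... | inj₂ la | inj₂ lb | inj₁ hc = inj₂ (inj₂ (≤->⇒cwLt x hc la , >->-<⇒cwLt x la lb ab))
      ... | inj₂ la | inj₂ lb | inj₂ lc = inj₁ (>->-<⇒cwLt x la lb ab , >->-<⇒cwLt x lb lc bc)

      cwLt-cwLt⇒cyclic : ∀ {a b c} → cwLt x a b → cwLt x b c → Q<.Cyclic a b c
      cwLt-cwLt⇒cyclic (inj₁ (ha , hb , ab)) (inj₁ (_ , hc , bc)) = inj₁ (ab , bc)
      cwLt-cwLt⇒cyclic (inj₁ (ha , hb , ab)) (inj₂ (inj₁ (_ , lc))) = inj₂ (inj₂ (<-≤-trans lc ha , ab))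
      cwLt-cwLt⇒cyclic (inj₁ (ha , hb , ab)) (inj₂ (inj₂ (lb , _))) = ⊥-elim (<-irrefl refl (<-≤-trans lb hb))
      cwLt-cwLt⇒cyclic (inj₂ (inj₁ (ha , lb))) (inj₁ (hb , _)) = ⊥-elim (<-irrefl refl (<-≤-trans lb hb))
      cwLt-cwLt⇒cyclic (inj₂ (inj₁ (ha , lb))) (inj₂ (inj₁ (hb , _))) = ⊥-elim (<-irrefl refl (<-≤-trans lb hb))
      cwLt-cwLt⇒cyclic (inj₂ (inj₁ (ha , lb))) (inj₂ (inj₂ (_ , lc , bc))) = inj₂ (inj₁ (bc , <-≤-trans lc ha))
      cwLt-cwLt⇒cyclic (inj₂ (inj₂ (la , lb , ab))) (inj₁ (hb , _)) = ⊥-elim (<-irrefl refl (<-≤-trans lb hb))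
      cwLt-cwLt⇒cyclic (inj₂ (inj₂ (la , lb , ab))) (inj₂ (inj₁ (hb , _))) = ⊥-elim (<-irrefl refl (<-≤-trans lb hb))
      cwLt-cwLt⇒cyclic (inj₂ (inj₂ (la , lb , ab))) (inj₂ (inj₂ (_ , lc , bc))) = inj₁ (ab , bc)

    cyclic⇒cyclicˣ : ∀ {a b c} → Q<.Cyclic a b c → Cw.Cyclic x a b c
    cyclic⇒cyclicˣ (inj₁ (p , q)) = <-<⇒cyclicˣ p q
    cyclic⇒cyclicˣ (inj₂ (inj₁ (p , q))) = Cw.Cyclic-rotate x (Cw.Cyclic-rotate x (<-<⇒cyclicˣ p q))
    cyclic⇒cyclicˣ (inj₂ (inj₂ (p , q))) = Cw.Cyclic-rotate x (<-<⇒cyclicˣ p q)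

    cyclicˣ⇒cyclic : ∀ {a b c} → Cw.Cyclic x a b c → Q<.Cyclic a b c
    cyclicˣ⇒cyclic (inj₁ (p , q)) = cwLt-cwLt⇒cyclic p q
    cyclicˣ⇒cyclic (inj₂ (inj₁ (p , q))) = Q<.Cyclic-rotate (Q<.Cyclic-rotate (cwLt-cwLt⇒cyclic p q))
    cyclicˣ⇒cyclic (inj₂ (inj₂ (p , q))) = Q<.Cyclic-rotate (cwLt-cwLt⇒cyclic p q)

    private
      cwLt⇒rebased : ∀ {y p q} → cwLt y p q → Q<.Rebased y p q
      cwLt⇒rebased (inj₁ (yp , yq , pq)) = inj₁ (≤⇒⊑ yp , pq)
      cwLt⇒rebased (inj₂ (inj₁ (yp , qy))) = inj₂ (inj₁ (qy , ≤⇒⊑ yp))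
      cwLt⇒rebased (inj₂ (inj₂ (py , qy , pq))) = inj₂ (inj₂ (pq , qy))

      rebased⇒cwLt : ∀ {y p q} → Q<.Rebased y p q → cwLt y p q
      rebased⇒cwLt (inj₁ (yp , pq)) = inj₁ (⊑⇒≤ yp , <⇒≤ (Q<.⊑-⊏-trans yp pq) , pq)
      rebased⇒cwLt (inj₂ (inj₁ (qy , yp))) = inj₂ (inj₁ (⊑⇒≤ yp , qy))
      rebased⇒cwLt (inj₂ (inj₂ (pq , qy))) = inj₂ (inj₂ (<-trans pq qy , qy , pq))

      cyclicallyBefore⇒ˣ : ∀ {y p q} → Q<.CyclicallyBefore y p q → Cw.CyclicallyBefore x y p q
      cyclicallyBefore⇒ˣ (inj₁ e) = inj₁ e
      cyclicallyBefore⇒ˣ (inj₂ c) = inj₂ (cyclic⇒cyclicˣ c)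

      cyclicallyBeforeˣ⇒ : ∀ {y p q} → Cw.CyclicallyBefore x y p q → Q<.CyclicallyBefore y p q
      cyclicallyBeforeˣ⇒ (inj₁ e) = inj₁ e
      cyclicallyBeforeˣ⇒ (inj₂ c) = inj₂ (cyclicˣ⇒cyclic c)

    cwLt⇒rebasedˣ : ∀ {y p q} → cwLt y p q → Cw.Rebased x y p q
    cwLt⇒rebasedˣ = Cw.cyclicallyBefore⇒rebased x ∘ cyclicallyBefore⇒ˣ ∘ Q<.rebased⇒cyclicallyBefore ∘ cwLt⇒rebased

    rebasedˣ⇒cwLt : ∀ {y p q} → Cw.Rebased x y p q → cwLt y p q
    rebasedˣ⇒cwLt = rebased⇒cwLt ∘ Q<.cyclicallyBefore⇒rebased ∘ cyclicallyBeforeˣ⇒ ∘ Cw.rebased⇒cyclicallyBefore x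

    crossing⇒crossingˣ : ∀ {a b c d} → Q<.Crossing a b c d → Cw.Crossing x a b c d
    crossing⇒crossingˣ cr with Q<.crossing⇒cyclic cr
    ... | inj₁ (p , q) = Cw.cyclic⇒crossing x (inj₁ (cyclic⇒cyclicˣ p , cyclic⇒cyclicˣ q))
    ... | inj₂ (p , q) = Cw.cyclic⇒crossing x (inj₂ (cyclic⇒cyclicˣ p , cyclic⇒cyclicˣ q))

    crossingˣ⇒crossing : ∀ {a b c d} → Cw.Crossing x a b c d → Q<.Crossing a b c d
    crossingˣ⇒crossing cr with Cw.crossing⇒cyclic x cr
    ... | inj₁ (p , q) = Q<.cyclic⇒crossing (inj₁ (cyclicˣ⇒cyclic p , cyclicˣ⇒cyclic q))
    ... | inj₂ (p , q) = Q<.cyclic⇒crossing (inj₂ (cyclicˣ⇒cyclic p , cyclicˣ⇒cyclic q))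

    satisfied⇒satisfiedˣ : ∀ {S a b} → Q<.SatisfiedBetween S a b → Cw.SatisfiedBetween x S a b
    satisfied⇒satisfiedˣ s with Q<.satisfied⇒cyclic s
    ... | (p , sp , cp) , (q , sq , cq) =
      Cw.cyclic⇒satisfied x ((p , sp , cyclic⇒cyclicˣ cp) , (q , sq , cyclic⇒cyclicˣ cq))

    satisfiedˣ⇒satisfied : ∀ {S a b} → Cw.SatisfiedBetween x S a b → Q<.SatisfiedBetween S a b
    satisfiedˣ⇒satisfied s with Cw.satisfied⇒cyclic x s
    ... | (p , sp , cp) , (q , sq , cq) =
      Q<.cyclic⇒satisfied ((p , sp , cyclicˣ⇒cyclic cp) , (q , sq , cyclicˣ⇒cyclic cq))

module Endpoints {n : ℕ} (C : CircleRep n) where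

  End : Set
  End = Fin n × Bool

  pt : End → ℚ
  pt (v , true) = l C v
  pt (v , false) = r C v

  partner : End → End
  partner (v , b) = v , not b

  chord : End → Fin n
  chord = proj₁

  partner-involutive : ∀ e → partner (partner e) ≡ e
  partner-involutive (v , true) = refl
  partner-involutive (v , false) = refl

  partner-swap : ∀ {e e'} → e ≡ partner e' → partner e ≡ e'
  partner-swap {e} {e'} eq = trans (cong partner eq) (partner-involutive e')

  pt-partner-involutive : ∀ e → pt (partner (partner e)) ≡ pt e
  pt-partner-involutive e = cong pt (partner-involutive e)

  pt-injective : ∀ {e e'} → pt e ≡ pt e' → e ≡ e'
  pt-injective {v , true} {w , true} eq with l-inj C eq
  ... | refl = refl
  pt-injective {v , true} {w , false} eq = ⊥-elim (l≢r C v w eq)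
  pt-injective {v , false} {w , true} eq = ⊥-elim (l≢r C w v (sym eq))
  pt-injective {v , false} {w , false} eq with r-inj C eq
  ... | refl = refl

  pt-endpoint : ∀ e → (pt e ≡ l C (chord e)) ⊎ (pt e ≡ r C (chord e))
  pt-endpoint (v , true) = inj₁ refl
  pt-endpoint (v , false) = inj₂ refl

  ends : List End
  ends = map (λ v → v , true) (allFin n) ++ map (λ v → v , false) (allFin n)

  ∈-ends : ∀ e → e ∈ ends
  ∈-ends (v , true) = ∈-++⁺ˡ (∈-map⁺ (λ v → v , true) (∈-allFin v))
  ∈-ends (v , false) = ∈-++⁺ʳ (map (λ v → v , true) (allFin n)) (∈-map⁺ (λ v → v , false) (∈-allFin v))

  any-end? : {P : End → Set} → (∀ e → Dec (P e)) → Dec (∃ P)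
  any-end? P? with Fin.any? (λ v → P? (v , true)) | Fin.any? (λ v → P? (v , false))
  ... | yes (v , p) | _ = yes ((v , true) , p)
  ... | no _ | yes (v , p) = yes ((v , false) , p)
  ... | no ¬t | no ¬f = no λ { ((v , true) , p) → ¬t (v , p) ; ((v , false) , p) → ¬f (v , p) }

  AllEnds : (ℚ → ℚ → Set) → End → End → Set
  AllEnds R e f = R (pt e) (pt f) × R (pt e) (pt (partner f))
                × R (pt (partner e)) (pt f) × R (pt (partner e)) (pt (partner f))

  bothBefore : ∀ {y} e f → AllEnds (cwLt y) e f → BothBefore C y (chord e) (chord f)
  bothBefore (u , true) (v , true) (a , b , c , d) = a , b , c , d
  bothBefore (u , true) (v , false) (a , b , c , d) = b , a , d , c
  bothBefore (u , false) (v , true) (a , b , c , d) = c , d , a , b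
  bothBefore (u , false) (v , false) (a , b , c , d) = d , c , b , a

Labelling : ∀ {n} → CircleRep n → ℕ → Set
Labelling C k = Σ (ℕ → Point) λ τ → GoodCorners C k τ
  × (Σ (ℕ → Fin _) λ c →
      (∀ i → i <ℕ k → CloseChord C k τ i (c i))
    × (∀ i → 1 ≤ℕ i → i <ℕ k → InCorner C k τ i (c i))
    × ((InCorner C k τ 0 (c 0) × IndepSeries C (map c (upTo k)))
      ⊎ (IndepSeries C (map (c ∘ suc) (upTo (k ∸ 1)))
        × (2 <ℕ k → ∀ v → InCorner C k τ 0 v → Cross C v (c 1) × ¬ Cross C v (c (k ∸ 1)))
        × (k ≡ 2 → Clique C))))

module CutAt {n : ℕ} (C : CircleRep n) (x : ℚ) (x-corner : IsCorner C x) where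

  open RationalCircle
  open Endpoints C
  open Cw x public

  infix 4 _≺_ _≼_

  _≺_ : ℚ → ℚ → Set
  _≺_ = cwLt x

  _≼_ : ℚ → ℚ → Set
  _≼_ = _⊑_

  x≺pt : ∀ e → x ≺ pt e
  x≺pt e = cwLt-least x (pt≢x e)
    where
    pt≢x : ∀ e → pt e ≢ x
    pt≢x (v , true) eq = x-corner (v , inj₁ (sym eq))
    pt≢x (v , false) eq = x-corner (v , inj₂ (sym eq))

  private
    some-below : ∀ p → ∃ λ t → t < p
    some-below p = p - 1ℚ , subst (λ z → p - 1ℚ < z) (+-identityʳ p) (+-monoʳ-< p (toWitness {a? = - 1ℚ <? 0ℚ} _))

    gap-below : ∀ (L : List ℚ) p → ∃ λ t → t < p × (∀ q → q ∈ L → q < p → q < t)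
    gap-below [] p = proj₁ (some-below p) , proj₂ (some-below p) , λ q ()
    gap-below (q ∷ L) p with gap-below L p
    ... | t , t<p , below-t with q <? p
    ...   | no q≮p = t , t<p , λ { q' (here refl) q'<p → ⊥-elim (q≮p q'<p) ; q' (there m) → below-t q' m }
    ...   | yes q<p with q <? t
    ...     | yes q<t = t , t<p , λ { q' (here refl) _ → q<t ; q' (there m) → below-t q' m }
    ...     | no q≮t with <-dense q<p
    ...       | u , q<u , u<p = u , u<p , λ
      { q' (here refl) _ → q<u
      ; q' (there m) q'<p → <-trans (Q<.⊏-⊑-trans (below-t q' m q'<p) (Q<.⊐̸⇒⊑ q≮t)) q<u }

    landmarks : List ℚ
    landmarks = x ∷ map pt ends

    pt∈landmarks : ∀ e → pt e ∈ landmarks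
    pt∈landmarks e = there (∈-map⁺ pt (∈-ends e))

  -- A point strictly between pt e and the last of x and the chord endpoints before it.
  before : End → ℚ
  before e = proj₁ (gap-below landmarks (pt e))

  private
    before<pt : ∀ e → before e < pt e
    before<pt e = proj₁ (proj₂ (gap-below landmarks (pt e)))

    <pt⇒<before : ∀ e q → q ∈ landmarks → q < pt e → q < before e
    <pt⇒<before e = proj₂ (proj₂ (gap-below landmarks (pt e)))

    before∉landmarks : ∀ e q → q ∈ landmarks → before e ≢ q
    before∉landmarks e q m eq with <-cmp q (pt e)
    ... | tri< a _ _ = <-irrefl (sym eq) (<pt⇒<before e q m a)
    ... | tri≈ _ b _ = <-irrefl eq (subst (λ z → before e < z) (sym b) (before<pt e))
    ... | tri> _ _ c = <-irrefl eq (<-trans (before<pt e) c)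

    x<before : ∀ e → x < pt e → x < before e
    x<before e = <pt⇒<before e x (here refl)

  before-corner : ∀ e → IsCorner C (before e)
  before-corner e (v , inj₁ eq) = before∉landmarks e (pt (v , true)) (pt∈landmarks (v , true)) eq
  before-corner e (v , inj₂ eq) = before∉landmarks e (pt (v , false)) (pt∈landmarks (v , false)) eq

  before≺pt : ∀ e → before e ≺ pt e
  before≺pt e with ≤⊎> x (pt e)
  ... | inj₂ lo = >->-<⇒cwLt x (<-trans (before<pt e) lo) lo (before<pt e)
  ... | inj₁ hi with <-cmp x (pt e)
  ...   | tri< a _ _ = ≤-≤-<⇒cwLt x (<⇒≤ (x<before e a)) hi (before<pt e)
  ...   | tri≈ _ b _ = ⊥-elim (⊏-irrefl (subst (x ≺_) (sym b) (x≺pt e)))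
  ...   | tri> _ _ c = ⊥-elim (<-irrefl refl (<-≤-trans c hi))

  ≺pt⇒≺before : ∀ {f e} → pt f ≺ pt e → pt f ≺ before e
  ≺pt⇒≺before {f} {e} (inj₁ (hf , he , fe)) with <-cmp x (pt e)
  ... | tri< a _ _ = ≤-≤-<⇒cwLt x hf (<⇒≤ (x<before e a)) (<pt⇒<before e (pt f) (pt∈landmarks f) fe)
  ... | tri≈ _ b _ = ⊥-elim (⊏-irrefl (subst (x ≺_) (sym b) (x≺pt e)))
  ... | tri> _ _ c = ⊥-elim (<-irrefl refl (<-≤-trans c he))
  ≺pt⇒≺before {f} {e} (inj₂ (inj₁ (hf , le))) = ≤->⇒cwLt x hf (<-trans (before<pt e) le)
  ≺pt⇒≺before {f} {e} (inj₂ (inj₂ (lf , le , fe))) =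
    >->-<⇒cwLt x lf (<-trans (before<pt e) le) (<pt⇒<before e (pt f) (pt∈landmarks f) fe)

  before≺⇒≼ : ∀ {e f} → before e ≺ pt f → pt e ≼ pt f
  before≺⇒≼ {e} {f} b = ⊐̸⇒⊑ λ fe → ⊏-asym b (≺pt⇒≺before {f} {e} fe)

  ≼⇒before≺ : ∀ {e f} → pt e ≼ pt f → before e ≺ pt f
  ≼⇒before≺ {e} p = ⊏-⊑-trans (before≺pt e) p

  before-mono : ∀ {e f} → pt e ≺ pt f → before e ≺ before f
  before-mono {e} {f} p = ⊏-trans (before≺pt e) (≺pt⇒≺before {e} {f} p)

  cwLt-after : ∀ {y p q} → y ≼ p → p ≺ q → cwLt y p q
  cwLt-after yp pq = rebasedˣ⇒cwLt (inj₁ (yp , pq))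

  cwLt-across : ∀ {y p q} → y ≼ p → q ≺ y → cwLt y p q
  cwLt-across yp qy = rebasedˣ⇒cwLt (inj₂ (inj₁ (qy , yp)))

  cwLt-before : ∀ {y p q} → p ≺ q → q ≺ y → cwLt y p q
  cwLt-before pq qy = rebasedˣ⇒cwLt (inj₂ (inj₂ (pq , qy)))

  arc-inside : ∀ {a b p} → a ≺ b → a ≺ p → p ≺ b → Arc a b p
  arc-inside ab ap pb = cwLt-after ⊑-refl ap , cwLt-after (inj₂ ap) pb

  arc-wrapping : ∀ {a b p} → b ≺ a → (a ≺ p) ⊎ (p ≺ b) → Arc a b p
  arc-wrapping ba (inj₁ ap) = cwLt-after ⊑-refl ap , cwLt-across (inj₂ ap) ba
  arc-wrapping ba (inj₂ pb) = cwLt-across ⊑-refl (⊏-trans pb ba) , cwLt-before pb ba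

  arc-inside⁻ : ∀ {a b p} → a ≺ b → Arc a b p → a ≺ p × p ≺ b
  arc-inside⁻ ab (c1 , c2) with cwLt⇒rebasedˣ c1 | cwLt⇒rebasedˣ c2
  ... | inj₁ (_ , ap) | inj₁ (_ , pb) = ap , pb
  ... | _ | inj₂ (inj₁ (ba , _)) = ⊥-elim (⊏-asym ab ba)
  ... | _ | inj₂ (inj₂ (_ , ba)) = ⊥-elim (⊏-asym ab ba)
  ... | inj₂ (inj₁ (pa , _)) | inj₁ (a⊑p , _) = ⊥-elim (⊑⇒⊐̸ a⊑p pa)
  ... | inj₂ (inj₂ (ap , pa)) | _ = ⊥-elim (⊏-asym ap pa)

  arc-wrapping⁻ : ∀ {a b p} → b ≺ a → Arc a b p → (a ≺ p) ⊎ (p ≺ b)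
  arc-wrapping⁻ ba (c1 , c2) with cwLt⇒rebasedˣ c1 | cwLt⇒rebasedˣ c2
  ... | _ | inj₁ (_ , pb) = inj₂ pb
  ... | _ | inj₂ (inj₂ (pb , _)) = inj₂ pb
  ... | inj₁ (_ , ap) | inj₂ (inj₁ _) = inj₁ ap
  ... | inj₂ (inj₁ (pa , _)) | inj₂ (inj₁ (_ , a⊑p)) = ⊥-elim (⊑⇒⊐̸ a⊑p pa)
  ... | inj₂ (inj₂ (ap , pa)) | _ = ⊥-elim (⊏-asym ap pa)

  AllEnds-before : ∀ {y e f} → AllEnds _≺_ e f → pt f ≺ y → pt (partner f) ≺ y → AllEnds (cwLt y) e f
  AllEnds-before (a , b , c , d) f≺y f'≺y =
    cwLt-before a f≺y , cwLt-before b f'≺y , cwLt-before c f≺y , cwLt-before d f'≺y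

  module Placement (m : ℕ) (1≤m : 1 ≤ℕ m) (D : ℕ → End)
                   (D-increasing : ∀ {i j} → i <ℕ j → j ≤ℕ m → pt (D i) ≺ pt (D j)) where

    τ : ℕ → ℚ
    τ i = before (D i)

    τ-increasing : ∀ {i j} → i <ℕ j → j ≤ℕ m → τ i ≺ τ j
    τ-increasing {i} {j} i<j j≤m = before-mono {D i} {D j} (D-increasing i<j j≤m)

    -- Side s_i seen from the endpoints: as τ i lies just before D i, an endpoint is on s_i
    -- iff it lies in [D i, D (i + 1)), the last side wrapping round past x to D 0.
    Segment : ℕ → ℚ → Set
    Segment i p = (pt (D i) ≼ p × (i <ℕ m → p ≺ pt (D (suc i)))) ⊎ (i ≡ m × p ≺ pt (D 0))

    D∈Segment : ∀ i → Segment i (pt (D i))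
    D∈Segment i = inj₁ (⊑-refl , λ i<m → D-increasing (ℕ.n<1+n i) i<m)

    Segment⇒OnSide : ∀ {i} e → i ≤ℕ m → Segment i (pt e) → OnSide C (suc m) τ i (pt e)
    Segment⇒OnSide {i} e i≤m s with ℕ.m≤n⇒m<n∨m≡n i≤m
    Segment⇒OnSide {i} e _ (inj₁ (D≼e , e≺D)) | inj₁ i<m =
      subst (λ j → Arc (τ i) (τ j) (pt e)) (sym (nextIdx-< i<m))
        (arc-inside (τ-increasing (ℕ.n<1+n i) i<m) (≼⇒before≺ {D i} {e} D≼e) (≺pt⇒≺before {e} {D (suc i)} (e≺D i<m)))
    Segment⇒OnSide e _ (inj₂ (refl , _)) | inj₁ i<m = ⊥-elim (ℕ.<-irrefl refl i<m)
    Segment⇒OnSide e _ s | inj₂ refl =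
      subst (λ j → Arc (τ m) (τ j) (pt e)) (sym (nextIdx-last m)) (arc-wrapping (τ-increasing 1≤m ℕ.≤-refl) (wrap s))
      where
      wrap : Segment m (pt e) → (τ m ≺ pt e) ⊎ (pt e ≺ τ 0)
      wrap (inj₁ (D≼e , _)) = inj₁ (≼⇒before≺ {D m} {e} D≼e)
      wrap (inj₂ (_ , e≺D)) = inj₂ (≺pt⇒≺before {e} {D 0} e≺D)

    OnSide⇒Segment : ∀ {i} e → i ≤ℕ m → OnSide C (suc m) τ i (pt e) → Segment i (pt e)
    OnSide⇒Segment {i} e i≤m on with ℕ.m≤n⇒m<n∨m≡n i≤m
    ... | inj₁ i<m with arc-inside⁻ (τ-increasing (ℕ.n<1+n i) i<m) (subst (λ j → Arc (τ i) (τ j) (pt e)) (nextIdx-< i<m) on)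
    ...   | τ≺e , e≺τ = inj₁ (before≺⇒≼ {D i} {e} τ≺e , λ _ → ⊏-trans e≺τ (before≺pt (D (suc i))))
    OnSide⇒Segment e _ on | inj₂ refl
      with arc-wrapping⁻ (τ-increasing 1≤m ℕ.≤-refl) (subst (λ j → Arc (τ m) (τ j) (pt e)) (nextIdx-last m) on)
    ... | inj₁ τ≺e = inj₁ (before≺⇒≼ {D m} {e} τ≺e , λ m<m → ⊥-elim (ℕ.<-irrefl refl m<m))
    ... | inj₂ e≺τ = inj₂ (refl , ⊏-trans e≺τ (before≺pt (D 0)))

    -- The corners satisfy a chord as soon as its two endpoints lie in different segments.
    module Satisfying
      (covered : ∀ e → ∃ λ i → i ≤ℕ m × Segment i (pt e))
      (separated : ∀ e i → i ≤ℕ m → Segment i (pt e) → ¬ Segment i (pt (partner e))) where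

      private
        satisfied-from : ∀ (S : ℚ → Set) → (∀ i → i ≤ℕ m → S (τ i)) →
                         ∀ e → pt e ≺ pt (partner e) → SatisfiedBetween S (pt e) (pt (partner e))
        satisfied-from S Sτ e a≺b = inner , outer
          where
          a = pt e
          b = pt (partner e)

          inner : ∃ λ p → S p × Inner a b p
          inner with ℕ.anyUpTo? (λ j → (a ⊏? pt (D j)) ×-dec (pt (D j) ⊑? b)) (suc m)
          ... | yes (j , j≤m , a≺D , D≼b) =
                τ j , Sτ j (ℕ.≤-pred j≤m) , inj₁ (≺pt⇒≺before {e} {D j} a≺D , ⊏-⊑-trans (before≺pt (D j)) D≼b)
          ... | no none with covered e
          ...   | i , i≤m , s = ⊥-elim (separated e i i≤m s (shift s))
            where
            shift : Segment i a → Segment i b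
            shift (inj₁ (D≼a , a≺D)) =
              inj₁ (⊑-trans D≼a (inj₂ a≺b) , λ i<m → ⋢⇒⊐ (λ D≼b → none (suc i , s≤s i<m , a≺D i<m , D≼b)))
            shift (inj₂ (i≡m , a≺D)) = inj₂ (i≡m , ⋢⇒⊐ (λ D≼b → none (0 , s≤s z≤n , a≺D , D≼b)))

          outer : ∃ λ p → S p × Outer a b p
          outer with ℕ.anyUpTo? (λ j → (pt (D j) ⊑? a) ⊎-dec (b ⊏? pt (D j))) (suc m)
          ... | yes (j , j≤m , inj₁ D≼a) =
                τ j , Sτ j (ℕ.≤-pred j≤m) ,
                inj₁ (⊏-⊑-trans (before≺pt (D j)) D≼a , ⊏-⊑-trans (before≺pt (D j)) (⊑-trans D≼a (inj₂ a≺b)))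
          ... | yes (j , j≤m , inj₂ b≺D) =
                τ j , Sτ j (ℕ.≤-pred j≤m) ,
                inj₂ (⊏-trans a≺b (≺pt⇒≺before {partner e} {D j} b≺D) , ≺pt⇒≺before {partner e} {D j} b≺D)
          ... | no none = ⊥-elim (separated e m ℕ.≤-refl a∈last b∈last)
            where
            a∈last : Segment m a
            a∈last = inj₂ (refl , ⋢⇒⊐ (λ D≼a → none (0 , s≤s z≤n , inj₁ D≼a)))
            b∈last : Segment m b
            b∈last = inj₁ (⊐̸⇒⊑ (λ b≺D → none (m , ℕ.≤-refl , inj₂ b≺D)) , λ m<m → ⊥-elim (ℕ.<-irrefl refl m<m))

      satisfied : ∀ (S : ℚ → Set) → (∀ i → i ≤ℕ m → S (τ i)) → ∀ v → Satisfied C S v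
      satisfied S Sτ v with ⊏-compare (l C v) (r C v)
      ... | tri< l≺r _ _ = satisfiedˣ⇒satisfied (satisfied-from S Sτ (v , true) l≺r)
      ... | tri≈ _ l≡r _ = ⊥-elim (l≢r C v v l≡r)
      ... | tri> _ _ r≺l = satisfiedˣ⇒satisfied (SatisfiedBetween-sym (satisfied-from S Sτ (v , false) r≺l))

      τ-satisfiedBy : SatisfiedBy C (suc m)
      τ-satisfiedBy = τ ∘ toℕ , τ-injective , (λ i → before-corner (D (toℕ i))) ,
        satisfied (λ p → ∃ λ i → τ (toℕ i) ≡ p) (λ i i≤m → fromℕ< (s≤s i≤m) , cong τ (toℕ-fromℕ< (s≤s i≤m)))
        where
        τ-injective : ∀ {i j} → τ (toℕ i) ≡ τ (toℕ j) → i ≡ j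
        τ-injective {i} {j} eq with ℕ.<-cmp (toℕ i) (toℕ j)
        ... | tri< i<j _ _ = ⊥-elim (⊏-irrefl (subst (τ (toℕ i) ≺_) (sym eq) (τ-increasing i<j (ℕ.≤-pred (toℕ<n j)))))
        ... | tri≈ _ i≡j _ = toℕ-injective i≡j
        ... | tri> _ _ j<i = ⊥-elim (⊏-irrefl (subst (τ (toℕ j) ≺_) eq (τ-increasing j<i (ℕ.≤-pred (toℕ<n i)))))

      τ-good : GoodCorners C (suc m) τ
      τ-good = (λ i _ → before-corner (D i)) , ordered ,
               satisfied (λ p → ∃ λ i → i <ℕ suc m × τ i ≡ p) (λ i i≤m → i , s≤s i≤m , refl)
        where
        ordered : ∀ i j → i <ℕ j → j <ℕ suc m → cwLt (τ 0) (τ i) (τ j)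
        ordered zero j i<j j<k = cwLt-after ⊑-refl (τ-increasing i<j (ℕ.≤-pred j<k))
        ordered (suc i) j i<j j<k =
          cwLt-after (inj₂ (τ-increasing (s≤s z≤n) (ℕ.≤-pred (ℕ.<-trans i<j j<k)))) (τ-increasing i<j (ℕ.≤-pred j<k))

    D-close : ∀ i → i <ℕ suc m → CloseChord C (suc m) τ i (chord (D i))
    D-close i (s≤s i≤m) = pt (D i) , pt-endpoint (D i) , Segment⇒OnSide (D i) i≤m (D∈Segment i) ,
                          λ u → no-end (u , true) , no-end (u , false)
      where
      no-end : ∀ f → ¬ Arc (τ i) (pt (D i)) (pt f)
      no-end f a with arc-inside⁻ (before≺pt (D i)) a
      ... | τ≺f , f≺D = ⊑⇒⊐̸ (before≺⇒≼ {D i} {f} τ≺f) f≺D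

    private
      prevIdx≤m : ∀ i → i ≤ℕ m → prevIdx (suc m) i ≤ℕ m
      prevIdx≤m zero _ = ℕ.≤-refl
      prevIdx≤m (suc i) si≤m = ℕ.<⇒≤ si≤m

    inCorner : ∀ {i} e → i ≤ℕ m → Segment (prevIdx (suc m) i) (pt (partner e)) → Segment i (pt e) →
               InCorner C (suc m) τ i (chord e)
    inCorner {i} (v , true) i≤m s₁ s₂ =
      inj₂ (Segment⇒OnSide (v , false) (prevIdx≤m i i≤m) s₁ , Segment⇒OnSide (v , true) i≤m s₂)
    inCorner {i} (v , false) i≤m s₁ s₂ =
      inj₁ (Segment⇒OnSide (v , true) (prevIdx≤m i i≤m) s₁ , Segment⇒OnSide (v , false) i≤m s₂)

    inCorner⁻ : ∀ {i v} → i ≤ℕ m → InCorner C (suc m) τ i v →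
                ∃ λ e → chord e ≡ v × Segment (prevIdx (suc m) i) (pt (partner e)) × Segment i (pt e)
    inCorner⁻ {i} {v} i≤m (inj₁ (a , b)) =
      (v , false) , refl , OnSide⇒Segment (v , true) (prevIdx≤m i i≤m) a , OnSide⇒Segment (v , false) i≤m b
    inCorner⁻ {i} {v} i≤m (inj₂ (a , b)) =
      (v , true) , refl , OnSide⇒Segment (v , false) (prevIdx≤m i i≤m) a , OnSide⇒Segment (v , true) i≤m b

    module Series (partner∈Segment : ∀ i → i <ℕ m → Segment i (pt (partner (D (suc i))))) where

      D≼partner : ∀ i → i <ℕ m → pt (D i) ≼ pt (partner (D (suc i)))
      D≼partner i i<m with partner∈Segment i i<m
      ... | inj₁ (D≼p , _) = D≼p
      ... | inj₂ (refl , _) = ⊥-elim (ℕ.<-irrefl refl i<m)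

      partner≺D : ∀ i → i <ℕ m → pt (partner (D (suc i))) ≺ pt (D (suc i))
      partner≺D i i<m with partner∈Segment i i<m
      ... | inj₁ (_ , p≺D) = p≺D i<m
      ... | inj₂ (refl , _) = ⊥-elim (ℕ.<-irrefl refl i<m)

      D≺partner : ∀ i → suc i <ℕ m → pt (D (suc i)) ≺ pt (partner (D (suc (suc i))))
      D≺partner i si<m with D≼partner (suc i) si<m
      ... | inj₂ D≺p = D≺p
      ... | inj₁ eq = ⊥-elim (⊏-asym (D-increasing (ℕ.n<1+n (suc i)) si<m)
              (subst (λ z → pt z ≺ pt (D (suc i))) (partner-swap (pt-injective {D (suc i)} {partner (D (suc (suc i)))} eq))
                (partner≺D i (ℕ.<-trans (ℕ.n<1+n i) si<m))))

      D-tail-ordered : ∀ i → suc i <ℕ m → AllEnds _≺_ (D (suc i)) (D (suc (suc i)))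
      D-tail-ordered i si<m = d≺d , d≺p , ⊏-trans p≺d d≺d , ⊏-trans p≺d d≺p
        where
        d≺d = D-increasing (ℕ.n<1+n (suc i)) si<m
        d≺p = D≺partner i si<m
        p≺d = partner≺D i (ℕ.<-trans (ℕ.n<1+n i) si<m)

      D-tail-series : IndepSeries C (map (chord ∘ D ∘ suc) (upTo m))
      D-tail-series = subst (1 ≤ℕ_) (sym (length-map-upTo (chord ∘ D ∘ suc) m)) 1≤m , x ,
                      linked-map-upTo (chord ∘ D ∘ suc) m (λ i si<m → bothBefore (D (suc i)) (D (suc (suc i))) (D-tail-ordered i si<m))

      D-inCorner : ∀ i → 1 ≤ℕ i → i <ℕ suc m → InCorner C (suc m) τ i (chord (D i))
      D-inCorner (suc i) _ (s≤s si≤m) = inCorner (D (suc i)) si≤m (partner∈Segment i si≤m) (D∈Segment (suc i))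

      module FirstInCorner (D-last≺partner : pt (D m) ≺ pt (partner (D 0))) where

        D0-inCorner : InCorner C (suc m) τ 0 (chord (D 0))
        D0-inCorner = inCorner (D 0) z≤n (inj₁ (inj₂ D-last≺partner , λ m<m → ⊥-elim (ℕ.<-irrefl refl m<m))) (D∈Segment 0)

        private
          y : ℚ
          y = before (partner (D 0))

          D≼Dm : ∀ {i} → i ≤ℕ m → pt (D i) ≼ pt (D m)
          D≼Dm i≤m with ℕ.m≤n⇒m<n∨m≡n i≤m
          ... | inj₁ i<m = inj₂ (D-increasing i<m ℕ.≤-refl)
          ... | inj₂ refl = ⊑-refl

          D≺partner₀ : ∀ {i} → i ≤ℕ m → pt (D i) ≺ pt (partner (D 0))
          D≺partner₀ i≤m = ⊑-⊏-trans (D≼Dm i≤m) D-last≺partner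

          D≺y : ∀ i → i ≤ℕ m → pt (D i) ≺ y
          D≺y i i≤m = ≺pt⇒≺before {D i} {partner (D 0)} (D≺partner₀ i≤m)

          partner≺y : ∀ i → i <ℕ m → pt (partner (D (suc i))) ≺ y
          partner≺y i i<m = ≺pt⇒≺before {partner (D (suc i))} {partner (D 0)} (⊏-trans (partner≺D i i<m) (D≺partner₀ i<m))

          y≼partner₀ : y ≼ pt (partner (D 0))
          y≼partner₀ = inj₂ (before≺pt (partner (D 0)))

          D0≺partner1 : pt (D 0) ≺ pt (partner (D 1))
          D0≺partner1 with D≼partner 0 1≤m
          ... | inj₂ D≺p = D≺p
          ... | inj₁ eq = ⊥-elim (⊏-irrefl (subst (λ z → pt z ≺ pt (partner (D 0)))
                                                   (sym (partner-swap (pt-injective {D 0} {partner (D 1)} eq))) (D≺partner₀ 1≤m)))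

          D-ordered-from-y : ∀ i → suc i <ℕ suc m → AllEnds (cwLt y) (D i) (D (suc i))
          D-ordered-from-y zero _ =
            cwLt-before (D-increasing (s≤s z≤n) 1≤m) (D≺y 1 1≤m) , cwLt-before D0≺partner1 (partner≺y 0 1≤m) ,
            cwLt-across y≼partner₀ (D≺y 1 1≤m) , cwLt-across y≼partner₀ (partner≺y 0 1≤m)
          D-ordered-from-y (suc i) (s≤s si<m) =
            AllEnds-before {e = D (suc i)} {D (suc (suc i))} (D-tail-ordered i si<m) (D≺y (suc (suc i)) si<m) (partner≺y (suc i) si<m)

        D-series : IndepSeries C (map (chord ∘ D) (upTo (suc m)))
        D-series = subst (1 ≤ℕ_) (sym (length-map-upTo (chord ∘ D) (suc m))) (s≤s z≤n) , y ,
                   linked-map-upTo (chord ∘ D) (suc m) (λ i lt → bothBefore (D i) (D (suc i)) (D-ordered-from-y i lt))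

    module Conclusion
      (covered : ∀ e → ∃ λ i → i ≤ℕ m × Segment i (pt e))
      (separated : ∀ e i → i ≤ℕ m → Segment i (pt e) → ¬ Segment i (pt (partner e)))
      (partner∈Segment : ∀ i → i <ℕ m → Segment i (pt (partner (D (suc i))))) where

      open Satisfying covered separated
      open Series partner∈Segment

      first-in-corner : pt (D m) ≺ pt (partner (D 0)) → Labelling C (suc m)
      first-in-corner D-last≺partner =
        τ , τ-good , chord ∘ D , D-close , D-inCorner , inj₁ (D0-inCorner , D-series)
        where open FirstInCorner D-last≺partner

      tail-series : (2 <ℕ suc m → ∀ v → InCorner C (suc m) τ 0 v → Cross C v (chord (D 1)) × ¬ Cross C v (chord (D m))) →
                    (suc m ≡ 2 → Clique C) → Labelling C (suc m)
      tail-series corner₀ clique =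
        τ , τ-good , chord ∘ D , D-close , D-inCorner , inj₂ (D-tail-series , corner₀ , clique)

  Separates : End → End → Set
  Separates e f = (Cyclic (pt e) (pt f) (pt (partner e)) × Cyclic (pt (partner e)) (pt (partner f)) (pt e))
                ⊎ (Cyclic (pt (partner e)) (pt f) (pt e) × Cyclic (pt e) (pt (partner f)) (pt (partner e)))

  separates⇒Cross : ∀ e f → Separates e f → Cross C (chord e) (chord f)
  separates⇒Cross e f s = crossingˣ⇒crossing {x} (cyclic⇒crossing (reorder e f s))
    where
    reorder : ∀ e f → Separates e f → CrossingCyclic (l C (chord e)) (r C (chord e)) (l C (chord f)) (r C (chord f))
    reorder (u , true) (w , true) (inj₁ (c₁ , c₂)) = inj₁ (c₁ , c₂)
    reorder (u , true) (w , false) (inj₁ (c₁ , c₂)) = inj₂ (c₂ , c₁)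
    reorder (u , false) (w , true) (inj₁ (c₁ , c₂)) = inj₂ (c₁ , c₂)
    reorder (u , false) (w , false) (inj₁ (c₁ , c₂)) = inj₁ (c₂ , c₁)
    reorder (u , true) (w , true) (inj₂ (c₁ , c₂)) = inj₂ (c₁ , c₂)
    reorder (u , true) (w , false) (inj₂ (c₁ , c₂)) = inj₁ (c₂ , c₁)
    reorder (u , false) (w , true) (inj₂ (c₁ , c₂)) = inj₁ (c₁ , c₂)
    reorder (u , false) (w , false) (inj₂ (c₁ , c₂)) = inj₂ (c₂ , c₁)

  Cross⇒separates : ∀ e f → Cross C (chord e) (chord f) → Separates e f
  Cross⇒separates e f cr = reorder e f (crossing⇒cyclic (crossing⇒crossingˣ {x} cr))
    where
    reorder : ∀ e f → CrossingCyclic (l C (chord e)) (r C (chord e)) (l C (chord f)) (r C (chord f)) → Separates e f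
    reorder (u , true) (w , true) (inj₁ (c₁ , c₂)) = inj₁ (c₁ , c₂)
    reorder (u , true) (w , true) (inj₂ (c₁ , c₂)) = inj₂ (c₁ , c₂)
    reorder (u , true) (w , false) (inj₁ (c₁ , c₂)) = inj₂ (c₂ , c₁)
    reorder (u , true) (w , false) (inj₂ (c₁ , c₂)) = inj₁ (c₂ , c₁)
    reorder (u , false) (w , true) (inj₁ (c₁ , c₂)) = inj₂ (c₁ , c₂)
    reorder (u , false) (w , true) (inj₂ (c₁ , c₂)) = inj₁ (c₁ , c₂)
    reorder (u , false) (w , false) (inj₁ (c₁ , c₂)) = inj₁ (c₂ , c₁)
    reorder (u , false) (w , false) (inj₂ (c₁ , c₂)) = inj₂ (c₂ , c₁)

  interleaved⇒Cross : ∀ e f → pt e ≺ pt f → pt f ≺ pt (partner e) → pt (partner e) ≺ pt (partner f) →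
                      Cross C (chord e) (chord f)
  interleaved⇒Cross e f a b c = separates⇒Cross e f (inj₁ (inj₁ (a , b) , Cyclic-rotate (inj₁ (⊏-trans a b , c))))

  interleaved⇒Cross′ : ∀ e f → pt f ≺ pt e → pt e ≺ pt (partner f) → pt (partner f) ≺ pt (partner e) →
                       Cross C (chord e) (chord f)
  interleaved⇒Cross′ e f a b c =
    separates⇒Cross e f (inj₂ (Cyclic-rotate (Cyclic-rotate (inj₁ (a , ⊏-trans b c))) , inj₁ (b , c)))

  nested⇒¬Cross : ∀ e f → pt e ≺ pt f → pt f ≺ pt (partner e) → pt e ≺ pt (partner f) → pt (partner f) ≺ pt (partner e) →
                  ¬ Cross C (chord e) (chord f)
  nested⇒¬Cross e f a b c d cr with Cross⇒separates e f cr
  ... | inj₁ (_ , c₂) = Cyclic-asym c₂ (inj₁ (c , d))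
  ... | inj₂ (c₁ , _) = Cyclic-asym c₁ (inj₁ (a , b))

  First : End → Set
  First e = ∀ e' → pt e ≼ pt e'

  ClosesAfter : End → End → Set
  ClosesAfter e e' = pt e ≼ pt (partner e') × pt (partner e') ≺ pt e'

  ClosesAfter? : ∀ e e' → Dec (ClosesAfter e e')
  ClosesAfter? e e' = (pt e ⊑? pt (partner e')) ×-dec (pt (partner e') ⊏? pt e')

  FirstClosingAfter : End → End → Set
  FirstClosingAfter e e' = ClosesAfter e e' × (∀ e'' → ClosesAfter e e'' → pt e' ≼ pt e'')

  GreedyChain : ℕ → (ℕ → End) → Set
  GreedyChain m F = First (F 0) × (∀ i → i <ℕ m → FirstClosingAfter (F i) (F (suc i)))

  MaximalGreedyChain : ℕ → (ℕ → End) → Set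
  MaximalGreedyChain m F = GreedyChain m F × (∀ e → ¬ ClosesAfter (F m) e)

  first-closesAfter-partner : ∀ e → First e → ClosesAfter e (partner e)
  first-closesAfter-partner (v , true) first = ⊑-refl , distinct (first (v , false))
    where
    distinct : l C v ≼ r C v → l C v ≺ r C v
    distinct (inj₁ eq) = ⊥-elim (l≢r C v v eq)
    distinct (inj₂ l≺r) = l≺r
  first-closesAfter-partner (v , false) first = ⊑-refl , distinct (first (v , true))
    where
    distinct : r C v ≼ l C v → r C v ≺ l C v
    distinct (inj₁ eq) = ⊥-elim (l≢r C v v (sym eq))
    distinct (inj₂ r≺l) = r≺l

  module _ {m F} (chain : GreedyChain m F) where

    private
      step-≺ : ∀ j → j <ℕ m → pt (F j) ≺ pt (F (suc j))
      step-≺ j j<m with proj₁ (proj₂ chain j j<m)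
      ... | F≼p , p≺F = ⊑-⊏-trans F≼p p≺F

    chain-increasing : ∀ {i j} → i <ℕ j → j ≤ℕ m → pt (F i) ≺ pt (F j)
    chain-increasing {i} {suc j} (s≤s i≤j) sj≤m with ℕ.m≤n⇒m<n∨m≡n i≤j
    ... | inj₁ i<j = ⊏-trans (chain-increasing i<j (ℕ.<⇒≤ sj≤m)) (step-≺ j sj≤m)
    ... | inj₂ refl = step-≺ i sj≤m

    chain-≼ : ∀ {i j} → i ≤ℕ j → j ≤ℕ m → pt (F i) ≼ pt (F j)
    chain-≼ i≤j j≤m with ℕ.m≤n⇒m<n∨m≡n i≤j
    ... | inj₁ i<j = inj₂ (chain-increasing i<j j≤m)
    ... | inj₂ refl = ⊑-refl

  maximal-positive : ∀ {m F} → MaximalGreedyChain m F → 1 ≤ℕ m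
  maximal-positive {zero} {F} ((first , _) , stuck) = ⊥-elim (stuck (partner (F 0)) (first-closesAfter-partner (F 0) first))
  maximal-positive {suc m} _ = s≤s z≤n

  module GreedyConstruction (e₀ : End) where

    private
      first : Σ End First
      first with argmin pt (λ _ → ⊤) (λ _ → yes tt) ends
      ... | inj₁ none = ⊥-elim (none e₀ (∈-ends e₀) tt)
      ... | inj₂ (e , _ , least) = e , λ e' → least e' (∈-ends e') tt

      next : End → End
      next e with argmin pt (ClosesAfter e) (ClosesAfter? e) ends
      ... | inj₁ _ = e
      ... | inj₂ (e' , _) = e'

      next-spec : ∀ e → (∀ e' → ¬ ClosesAfter e e') ⊎ FirstClosingAfter e (next e)
      next-spec e with argmin pt (ClosesAfter e) (ClosesAfter? e) ends
      ... | inj₁ none = inj₁ (λ e' → none e' (∈-ends e'))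
      ... | inj₂ (e' , c , least) = inj₂ (c , λ e'' c'' → least e'' (∈-ends e'') c'')

    greedy : ℕ → End
    greedy zero = proj₁ first
    greedy (suc i) = next (greedy i)

    greedy-chain-or-maximal : ∀ j → GreedyChain j greedy ⊎ (∃ λ m → MaximalGreedyChain m greedy)
    greedy-chain-or-maximal zero = inj₁ (proj₂ first , λ i ())
    greedy-chain-or-maximal (suc j) with greedy-chain-or-maximal j
    ... | inj₂ maximal = inj₂ maximal
    ... | inj₁ chain with next-spec (greedy j)
    ...   | inj₁ stuck = inj₂ (j , chain , stuck)
    ...   | inj₂ step = inj₁ (proj₁ chain , steps)
      where
      steps : ∀ i → i <ℕ suc j → FirstClosingAfter (greedy i) (greedy (suc i))
      steps i (s≤s i≤j) with ℕ.m≤n⇒m<n∨m≡n i≤j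
      ... | inj₁ i<j = proj₂ chain i i<j
      ... | inj₂ refl = step

  module Maximal {m F} (maximal : MaximalGreedyChain m F) where

    chain : GreedyChain m F
    chain = proj₁ maximal

    open Placement m (maximal-positive {F = F} maximal) F (chain-increasing {F = F} chain) public

    in-segment : ∀ {i} e → Segment i (pt e) → pt (F i) ≼ pt e × (i <ℕ m → pt e ≺ pt (F (suc i)))
    in-segment e (inj₁ s) = s
    in-segment e (inj₂ (_ , e≺F₀)) = ⊥-elim (⊑⇒⊐̸ (proj₁ chain e) e≺F₀)

    private
      last-reached : ∀ e j → j ≤ℕ m →
        ∃ λ i → i ≤ℕ j × pt (F i) ≼ pt e × (i <ℕ j → pt e ≺ pt (F (suc i)))
      last-reached e zero _ = 0 , z≤n , proj₁ chain e , λ ()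
      last-reached e (suc j) sj≤m with pt (F (suc j)) ⊑? pt e
      ... | yes F≼e = suc j , ℕ.≤-refl , F≼e , λ j<j → ⊥-elim (ℕ.<-irrefl refl j<j)
      ... | no F⋠e with last-reached e j (ℕ.<⇒≤ sj≤m)
      ...   | i , i≤j , F≼e , e≺F = i , ℕ.m≤n⇒m≤1+n i≤j , F≼e , e≺next
        where
        e≺next : i <ℕ suc j → pt e ≺ pt (F (suc i))
        e≺next (s≤s i≤j′) with ℕ.m≤n⇒m<n∨m≡n i≤j′
        ... | inj₁ i<j = e≺F i<j
        ... | inj₂ refl = ⋢⇒⊐ F⋠e

      -- A chord inside segment i would close after F i before F (i + 1), against greediness.
      closes-inside : ∀ e' i → i ≤ℕ m → ClosesAfter (F i) e' → ¬ (i <ℕ m → pt e' ≺ pt (F (suc i)))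
      closes-inside e' i i≤m closes e'≺F with ℕ.m≤n⇒m<n∨m≡n i≤m
      ... | inj₁ i<m = ⊑⇒⊐̸ (proj₂ (proj₂ chain i i<m) e' closes) (e'≺F i<m)
      ... | inj₂ refl = proj₂ maximal e' closes

      chord-separated : ∀ v i → i ≤ℕ m → Segment i (l C v) → ¬ Segment i (r C v)
      chord-separated v i i≤m sl sr with in-segment (v , true) sl | in-segment (v , false) sr | ⊏-compare (l C v) (r C v)
      ... | F≼l , _ | _ , r≺F | tri< l≺r _ _ = closes-inside (v , false) i i≤m (F≼l , l≺r) r≺F
      ... | _ | _ | tri≈ _ l≡r _ = l≢r C v v l≡r
      ... | _ , l≺F | F≼r , _ | tri> _ _ r≺l = closes-inside (v , true) i i≤m (F≼r , r≺l) l≺F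

    covered : ∀ e → ∃ λ i → i ≤ℕ m × Segment i (pt e)
    covered e with last-reached e m ℕ.≤-refl
    ... | i , i≤m , F≼e , e≺F = i , i≤m , inj₁ (F≼e , e≺F)

    separated : ∀ e i → i ≤ℕ m → Segment i (pt e) → ¬ Segment i (pt (partner e))
    separated (v , true) i i≤m s s′ = chord-separated v i i≤m s s′
    separated (v , false) i i≤m s s′ = chord-separated v i i≤m s′ s

    open Satisfying covered separated public

    partner∈Segment : ∀ i → i <ℕ m → Segment i (pt (partner (F (suc i))))
    partner∈Segment i i<m with proj₁ (proj₂ chain i i<m)
    ... | F≼p , p≺F = inj₁ (F≼p , λ _ → p≺F)

    open Series partner∈Segment public
    open Conclusion covered separated partner∈Segment public


  module LongChain {j F} (maximal : MaximalGreedyChain (suc (suc j)) F) where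

    private
      m : ℕ
      m = suc (suc j)

    open Maximal {F = F} maximal

    -- The chords in corner τ 0, seen from their endpoint on s 0.
    Wraps : End → Set
    Wraps e = pt e ≺ pt (F 1) × pt (F m) ≼ pt (partner e)

    Wraps? : ∀ e → Dec (Wraps e)
    Wraps? e = (pt e ⊏? pt (F 1)) ×-dec (pt (F m) ⊑? pt (partner e))

    Encloses : End → Set
    Encloses e = Wraps e × pt e ≺ pt (partner (F 1))

    Encloses? : ∀ e → Dec (Encloses e)
    Encloses? e = Wraps? e ×-dec (pt e ⊏? pt (partner (F 1)))

    private
      F1≺Fm : pt (F 1) ≺ pt (F m)
      F1≺Fm = chain-increasing {F = F} chain (s≤s (s≤s z≤n)) ℕ.≤-refl

      F1≼partner-Fm : pt (F 1) ≼ pt (partner (F m))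
      F1≼partner-Fm = ⊑-trans (chain-≼ {F = F} chain (s≤s z≤n) (ℕ.n≤1+n (suc j))) (D≼partner (suc j) ℕ.≤-refl)

    none-encloses : (∀ e → ¬ Encloses e) → Labelling C (suc m)
    none-encloses none = tail-series corner₀ (λ ())
      where
      corner₀ : 2 <ℕ suc m → ∀ v → InCorner C (suc m) τ 0 v → Cross C v (chord (F 1)) × ¬ Cross C v (chord (F m))
      corner₀ _ v inC with inCorner⁻ {0} {v} z≤n inC
      ... | e , refl , partner∈last , e∈first = crosses , ¬crosses
        where
        e≺F1 : pt e ≺ pt (F 1)
        e≺F1 = proj₂ (in-segment e e∈first) (s≤s z≤n)

        Fm≼partner : pt (F m) ≼ pt (partner e)
        Fm≼partner = proj₁ (in-segment (partner e) partner∈last)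

        partner-F1≺e : pt (partner (F 1)) ≺ pt e
        partner-F1≺e with pt e ⊑? pt (partner (F 1))
        ... | no e⋠p = ⋢⇒⊐ e⋠p
        ... | yes (inj₂ e≺p) = ⊥-elim (none e ((e≺F1 , Fm≼partner) , e≺p))
        ... | yes (inj₁ eq) = ⊥-elim (⊑⇒⊐̸ Fm≼partner
                (subst (λ z → pt z ≺ pt (F m)) (sym (partner-swap (pt-injective {e} {partner (F 1)} eq))) F1≺Fm))

        Fm≺partner : pt (F m) ≺ pt (partner e)
        Fm≺partner with Fm≼partner
        ... | inj₂ Fm≺p = Fm≺p
        ... | inj₁ eq = ⊥-elim (⊑⇒⊐̸ F1≼partner-Fm
                (subst (λ z → pt z ≺ pt (F 1)) (sym (partner-swap (pt-injective {F m} {partner e} eq))) e≺F1))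

        e≺partner : pt e ≺ pt (partner e)
        e≺partner = ⊏-trans (⊏-trans e≺F1 F1≺Fm) Fm≺partner

        crosses : Cross C (chord e) (chord (F 1))
        crosses = separates⇒Cross e (F 1)
          (inj₁ (inj₁ (e≺F1 , ⊏-trans F1≺Fm Fm≺partner) , Cyclic-rotate (Cyclic-rotate (inj₁ (partner-F1≺e , e≺partner)))))

        ¬crosses : ¬ Cross C (chord e) (chord (F m))
        ¬crosses = nested⇒¬Cross e (F m) (⊏-trans e≺F1 F1≺Fm) Fm≺partner (⊏-⊑-trans e≺F1 F1≼partner-Fm)
                     (⊏-trans (partner≺D (suc j) ℕ.≤-refl) Fm≺partner)

    -- Replacing F 0 by the first wrapping endpoint q moves τ 0 so that the chord of q is in it.
    module FromFirstWrapping (q : End) (q-wraps : Wraps q) (q-least : ∀ e → e ∈ ends → Wraps e → pt q ≼ pt e)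
                             (e₁ : End) (e₁-encloses : Encloses e₁) where

      D : ℕ → End
      D zero = q
      D (suc i) = F (suc i)

      private
        q≺F1 : pt q ≺ pt (F 1)
        q≺F1 = proj₁ q-wraps

      D-increasing : ∀ {i i'} → i <ℕ i' → i' ≤ℕ m → pt (D i) ≺ pt (D i')
      D-increasing {zero} {suc i'} _ si'≤m = ⊏-⊑-trans q≺F1 (chain-≼ {F = F} chain (s≤s z≤n) si'≤m)
      D-increasing {suc i} {suc i'} i<i' si'≤m = chain-increasing {F = F} chain i<i' si'≤m

      module P = Placement m (s≤s z≤n) D D-increasing

      private
        first : ∀ e → pt (F 0) ≼ pt e
        first = proj₁ chain

        to-P : ∀ i e → Segment (suc i) (pt e) → P.Segment (suc i) (pt e)
        to-P i e (inj₁ s) = inj₁ s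
        to-P i e (inj₂ (_ , e≺F₀)) = ⊥-elim (⊑⇒⊐̸ (first e) e≺F₀)

        from-P : ∀ i e → P.Segment i (pt e) → Segment i (pt e) ⊎ (i ≡ m × pt e ≺ pt q)
        from-P zero e (inj₁ (_ , e≺F1)) = inj₁ (inj₁ (first e , e≺F1))
        from-P zero e (inj₂ (() , _))
        from-P (suc i) e (inj₁ s) = inj₁ (inj₁ s)
        from-P (suc i) e (inj₂ s) = inj₂ s

        ≺q⇒first-segment : ∀ e → pt e ≺ pt q → Segment 0 (pt e)
        ≺q⇒first-segment e e≺q = inj₁ (first e , λ _ → ⊏-trans e≺q q≺F1)

        -- A chord with one end before q and the other in the last segment would wrap before q.
        chord-separated : ∀ v i → i ≤ℕ m → P.Segment i (l C v) → ¬ P.Segment i (r C v)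
        chord-separated v i i≤m sl sr with from-P i (v , true) sl | from-P i (v , false) sr
        ... | inj₁ sl′ | inj₁ sr′ = separated (v , true) i i≤m sl′ sr′
        ... | inj₂ (_ , l≺q) | inj₂ (_ , r≺q) =
              separated (v , true) 0 z≤n (≺q⇒first-segment (v , true) l≺q) (≺q⇒first-segment (v , false) r≺q)
        ... | inj₁ sl′ | inj₂ (refl , r≺q) =
              ⊑⇒⊐̸ (q-least (v , false) (∈-ends (v , false)) (⊏-trans r≺q q≺F1 , proj₁ (in-segment (v , true) sl′))) r≺q
        ... | inj₂ (refl , l≺q) | inj₁ sr′ =
              ⊑⇒⊐̸ (q-least (v , true) (∈-ends (v , true)) (⊏-trans l≺q q≺F1 , proj₁ (in-segment (v , false) sr′))) l≺q

      covered′ : ∀ e → ∃ λ i → i ≤ℕ m × P.Segment i (pt e)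
      covered′ e with covered e
      ... | suc i , i≤m , s = suc i , i≤m , to-P i e s
      ... | zero , i≤m , s with pt q ⊑? pt e
      ...   | yes q≼e = 0 , i≤m , inj₁ (q≼e , λ _ → proj₂ (in-segment e s) (s≤s z≤n))
      ...   | no q⋠e = m , ℕ.≤-refl , inj₂ (refl , ⋢⇒⊐ q⋠e)

      separated′ : ∀ e i → i ≤ℕ m → P.Segment i (pt e) → ¬ P.Segment i (pt (partner e))
      separated′ (v , true) i i≤m s s′ = chord-separated v i i≤m s s′
      separated′ (v , false) i i≤m s s′ = chord-separated v i i≤m s′ s

      partner∈Segment′ : ∀ i → i <ℕ m → P.Segment i (pt (partner (D (suc i))))
      partner∈Segment′ zero i<m =
        inj₁ (inj₂ (⊑-⊏-trans (q-least e₁ (∈-ends e₁) (proj₁ e₁-encloses)) (proj₂ e₁-encloses)) , λ _ → partner≺D 0 i<m)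
      partner∈Segment′ (suc i) si<m = to-P i (partner (F (suc (suc i)))) (partner∈Segment (suc i) si<m)

      Fm≺partner-q : pt (F m) ≺ pt (partner q)
      Fm≺partner-q with proj₂ q-wraps
      ... | inj₂ Fm≺p = Fm≺p
      ... | inj₁ eq = ⊥-elim (⊑⇒⊐̸ F1≼partner-Fm
              (subst (λ z → pt z ≺ pt (F 1)) (sym (partner-swap (pt-injective {F m} {partner q} eq))) q≺F1))

      labelling : Labelling C (suc m)
      labelling = P.Conclusion.first-in-corner covered′ separated′ partner∈Segment′ Fm≺partner-q

    long-labelling : Labelling C (suc m)
    long-labelling with any-end? Encloses?
    ... | no none = none-encloses (λ e enc → none (e , enc))
    ... | yes (e₁ , enc₁) with argmin pt Wraps Wraps? ends
    ...   | inj₁ none = ⊥-elim (none e₁ (∈-ends e₁) (proj₁ enc₁))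
    ...   | inj₂ (q , q-wraps , q-least) = FromFirstWrapping.labelling q q-wraps q-least e₁ enc₁

  module ShortChain {F} (maximal : MaximalGreedyChain 1 F) where

    open Maximal {F = F} maximal

    Early : End → Set
    Early e = pt e ≺ pt (F 1)

    private
      first : ∀ e → pt (F 0) ≼ pt e
      first = proj₁ chain

      early⇒partner-late : ∀ e → Early e → pt (F 1) ≼ pt (partner e)
      early⇒partner-late e early =
        ⊐̸⇒⊑ λ p≺F1 → separated e 0 z≤n (inj₁ (first e , λ _ → early)) (inj₁ (first (partner e) , λ _ → p≺F1))

      late⇒partner-early : ∀ e → ¬ Early e → Early (partner e)
      late⇒partner-early e late with pt (partner e) ⊏? pt (F 1)
      ... | yes early = early
      ... | no late′ = ⊥-elim (separated e 1 ℕ.≤-refl (inj₁ (⊐̸⇒⊑ late , λ 1<1 → ⊥-elim (ℕ.<-irrefl refl 1<1)))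
                                                    (inj₁ (⊐̸⇒⊑ late′ , λ 1<1 → ⊥-elim (ℕ.<-irrefl refl 1<1))))

      early-end : ∀ w → Σ End λ e → chord e ≡ w × Early e
      early-end w with l C w ⊏? pt (F 1)
      ... | yes early = (w , true) , refl , early
      ... | no late = (w , false) , refl , late⇒partner-early (w , true) late

    Encloses : End → Set
    Encloses e = Early e × ∃ λ f → Early f × pt e ≺ pt f × pt (partner f) ≺ pt (partner e)

    Encloses? : ∀ e → Dec (Encloses e)
    Encloses? e = (pt e ⊏? pt (F 1))
      ×-dec any-end? (λ f → (pt f ⊏? pt (F 1)) ×-dec (pt e ⊏? pt f) ×-dec (pt (partner f) ⊏? pt (partner e)))

    -- Both chords start in the first segment and end in the second, so they cross unless nested.
    non-crossing⇒encloses : ∀ u v → u ≢ v → ¬ Cross C u v → ∃ Encloses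
    non-crossing⇒encloses u v u≢v ¬cross with early-end u | early-end v
    ... | eu , refl , eu-early | ev , refl , ev-early with ⊏-compare (pt eu) (pt ev)
    ...   | tri≈ _ eq _ = ⊥-elim (u≢v (cong chord (pt-injective {eu} {ev} eq)))
    ...   | tri< eu≺ev _ _ with ⊏-compare (pt (partner eu)) (pt (partner ev))
    ...     | tri< p≺p _ _ =
              ⊥-elim (¬cross (interleaved⇒Cross eu ev eu≺ev (⊏-⊑-trans ev-early (early⇒partner-late eu eu-early)) p≺p))
    ...     | tri≈ _ eq _ = ⊥-elim (u≢v (cong chord (pt-injective {partner eu} {partner ev} eq)))
    ...     | tri> _ _ p≻p = eu , eu-early , ev , ev-early , eu≺ev , p≻p
    non-crossing⇒encloses u v u≢v ¬cross | eu , refl , eu-early | ev , refl , ev-early | tri> _ _ ev≺eu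
      with ⊏-compare (pt (partner ev)) (pt (partner eu))
    ...     | tri< p≺p _ _ =
              ⊥-elim (¬cross (interleaved⇒Cross′ eu ev ev≺eu (⊏-⊑-trans eu-early (early⇒partner-late ev ev-early)) p≺p))
    ...     | tri≈ _ eq _ = ⊥-elim (u≢v (cong chord (pt-injective {partner eu} {partner ev} (sym eq))))
    ...     | tri> _ _ p≻p = ev , ev-early , eu , eu-early , ev≺eu , p≻p

    -- The chord of a goes into τ 0 and the chord of b, nested inside it, into τ 1.
    module FromFirstEnclosing (a : End) (a-encloses : Encloses a) (a-least : ∀ e → e ∈ ends → Encloses e → pt a ≼ pt e)
                              (b : End) (F1≼b : pt (F 1) ≼ pt b) (a≼partner-b : pt a ≼ pt (partner b))
                              (b-least : ∀ f → f ∈ ends → pt (F 1) ≼ pt f × pt a ≼ pt (partner f) → pt b ≼ pt f) where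

      D : ℕ → End
      D zero = a
      D (suc _) = b

      private
        a-early : Early a
        a-early = proj₁ a-encloses

        partner-b-early : Early (partner b)
        partner-b-early = late⇒partner-early b (⊑⇒⊐̸ F1≼b)

      D-increasing : ∀ {i i'} → i <ℕ i' → i' ≤ℕ 1 → pt (D i) ≺ pt (D i')
      D-increasing {zero} {suc zero} _ _ = ⊏-⊑-trans a-early F1≼b
      D-increasing {zero} {suc (suc _)} _ (s≤s ())
      D-increasing {suc _} {suc zero} (s≤s ()) _
      D-increasing {suc _} {suc (suc _)} _ (s≤s ())

      module P = Placement 1 ℕ.≤-refl D D-increasing

      private
        ≽a⇒partner-after-b : ∀ e → Early e → pt a ≼ pt e → pt b ≼ pt (partner e)
        ≽a⇒partner-after-b e early a≼e =
          b-least (partner e) (∈-ends (partner e))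
            (early⇒partner-late e early , subst (pt a ≼_) (sym (pt-partner-involutive e)) a≼e)

        -- Otherwise e would enclose partner b while lying before a.
        ≺a⇒partner-before-b : ∀ e → Early e → pt e ≺ pt a → pt (partner e) ≺ pt b
        ≺a⇒partner-before-b e early e≺a with pt (partner (partner b)) ⊏? pt (partner e)
        ... | yes ppb≺pe =
              ⊥-elim (⊑⇒⊐̸ (a-least e (∈-ends e) (early , partner b , partner-b-early , ⊏-⊑-trans e≺a a≼partner-b , ppb≺pe)) e≺a)
        ... | no ppb⊀pe with subst (pt (partner e) ≼_) (pt-partner-involutive b) (⊐̸⇒⊑ ppb⊀pe)
        ...   | inj₂ pe≺b = pe≺b
        ...   | inj₁ eq = ⊥-elim (⊑⇒⊐̸ a≼partner-b
                  (subst (λ w → pt w ≺ pt a) (trans (sym (partner-involutive e)) (cong partner (pt-injective {partner e} {b} eq))) e≺a))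

        early-separated : ∀ e i → i ≤ℕ 1 → Early e → P.Segment i (pt e) → ¬ P.Segment i (pt (partner e))
        early-separated e zero _ early (inj₁ (a≼e , _)) (inj₁ (_ , pe≺b)) =
          ⊑⇒⊐̸ (≽a⇒partner-after-b e early a≼e) (pe≺b (s≤s z≤n))
        early-separated e zero _ _ (inj₂ (() , _)) _
        early-separated e zero _ _ _ (inj₂ (() , _))
        early-separated e (suc zero) _ early (inj₁ (b≼e , _)) _ = ⊑⇒⊐̸ F1≼b (⊑-⊏-trans b≼e early)
        early-separated e (suc zero) _ early (inj₂ (_ , e≺a)) (inj₁ (b≼pe , _)) =
          ⊑⇒⊐̸ b≼pe (≺a⇒partner-before-b e early e≺a)
        early-separated e (suc zero) _ early (inj₂ (_ , e≺a)) (inj₂ (_ , pe≺a)) =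
          ⊑⇒⊐̸ (early⇒partner-late e early) (⊏-trans pe≺a a-early)
        early-separated e (suc (suc _)) (s≤s ()) _ _ _

      covered′ : ∀ e → ∃ λ i → i ≤ℕ 1 × P.Segment i (pt e)
      covered′ e with pt a ⊑? pt e | pt e ⊏? pt b
      ... | yes a≼e | yes e≺b = 0 , z≤n , inj₁ (a≼e , λ _ → e≺b)
      ... | no a⋠e | _ = 1 , ℕ.≤-refl , inj₂ (refl , ⋢⇒⊐ a⋠e)
      ... | yes _ | no e⊀b = 1 , ℕ.≤-refl , inj₁ (⊐̸⇒⊑ e⊀b , λ 1<1 → ⊥-elim (ℕ.<-irrefl refl 1<1))

      separated′ : ∀ e i → i ≤ℕ 1 → P.Segment i (pt e) → ¬ P.Segment i (pt (partner e))
      separated′ e i i≤1 s s′ with pt e ⊏? pt (F 1)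
      ... | yes early = early-separated e i i≤1 early s s′
      ... | no late = early-separated (partner e) i i≤1 (late⇒partner-early e late) s′
                        (subst (P.Segment i) (sym (pt-partner-involutive e)) s)

      partner∈Segment′ : ∀ i → i <ℕ 1 → P.Segment i (pt (partner (D (suc i))))
      partner∈Segment′ zero _ = inj₁ (a≼partner-b , λ _ → ⊏-⊑-trans partner-b-early F1≼b)
      partner∈Segment′ (suc _) (s≤s ())

      b≺partner-a : pt b ≺ pt (partner a)
      b≺partner-a with proj₂ a-encloses
      ... | f , f-early , a≺f , pf≺pa = ⊑-⊏-trans (≽a⇒partner-after-b f f-early (inj₂ a≺f)) pf≺pa

      labelling : Labelling C 2
      labelling = P.Conclusion.first-in-corner covered′ separated′ partner∈Segment′ b≺partner-a

    from-enclosing : ∃ Encloses → Labelling C 2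
    from-enclosing (e , enc) with argmin pt Encloses Encloses? ends
    ... | inj₁ none = ⊥-elim (none e (∈-ends e) enc)
    ... | inj₂ (a , a-encloses , a-least)
      with argmin pt (λ f → pt (F 1) ≼ pt f × pt a ≼ pt (partner f)) (λ f → (pt (F 1) ⊑? pt f) ×-dec (pt a ⊑? pt (partner f))) ends
    ...   | inj₁ none = ⊥-elim (none (partner a) (∈-ends (partner a))
                          (early⇒partner-late a (proj₁ a-encloses) , inj₁ (sym (pt-partner-involutive a))))
    ...   | inj₂ (b , (F1≼b , a≼pb) , b-least) = FromFirstEnclosing.labelling a a-encloses a-least b F1≼b a≼pb b-least

    short-labelling : Labelling C 2
    short-labelling with Fin.any? (λ u → Fin.any? (λ v → ¬? (u Fin.≟ v) ×-dec ¬? (Cross? C u v)))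
    ... | yes (u , v , u≢v , ¬cross) = from-enclosing (non-crossing⇒encloses u v u≢v ¬cross)
    ... | no all-cross = tail-series (λ 2<2 → ⊥-elim (ℕ.<-irrefl refl 2<2)) (λ _ → clique)
      where
      clique : Clique C
      clique u v u≢v with Cross? C u v
      ... | yes cross = cross
      ... | no ¬cross = ⊥-elim (all-cross (u , v , u≢v , ¬cross))

  maximal-tail-series : ∀ {m F} → MaximalGreedyChain m F → ∃ λ L → length L ≡ m × IndepSeries C L
  maximal-tail-series {m} {F} maximal =
    map (chord ∘ F ∘ suc) (upTo m) , length-map-upTo (chord ∘ F ∘ suc) m , Maximal.D-tail-series {F = F} maximal

  maximal-conclusion : ∀ {m F} → MaximalGreedyChain m F →
                       (∃ λ L → length L ≡ m × IndepSeries C L) × Labelling C (suc m)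
  maximal-conclusion {zero} {F} maximal = ⊥-elim (ℕ.<-irrefl refl (maximal-positive {F = F} maximal))
  maximal-conclusion {suc zero} {F} maximal =
    maximal-tail-series {F = F} maximal , ShortChain.short-labelling {F = F} maximal
  maximal-conclusion {suc (suc j)} {F} maximal =
    maximal-tail-series {F = F} maximal , LongChain.long-labelling {F = F} maximal

  module BoundedBy {k : ℕ} (σ : Fin k → ℚ) (σ-satisfies : ∀ v → Satisfied C (λ p → ∃ λ i → σ i ≡ p) v)
                   (i₀ : Fin k) (σ-x : σ i₀ ≡ x) where

    corner-inside : ∀ e → pt (partner e) ≺ pt e → ∃ λ j → pt (partner e) ≺ σ j × σ j ≺ pt e
    corner-inside (v , true) r≺l with satisfied⇒satisfiedˣ {x} (σ-satisfies v)
    ... | (_ , (j , refl) , inj₁ (l≺σ , σ≺r)) , _ = ⊥-elim (⊏-asym r≺l (⊏-trans l≺σ σ≺r))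
    ... | (_ , (j , refl) , inj₂ (r≺σ , σ≺l)) , _ = j , r≺σ , σ≺l
    corner-inside (v , false) l≺r with satisfied⇒satisfiedˣ {x} (σ-satisfies v)
    ... | (_ , (j , refl) , inj₁ (l≺σ , σ≺r)) , _ = j , l≺σ , σ≺r
    ... | (_ , (j , refl) , inj₂ (r≺σ , σ≺l)) , _ = ⊥-elim (⊏-asym l≺r (⊏-trans r≺σ σ≺l))

    -- Below each F (i + 1) lies a corner inside the chord it closes; together with x these
    -- corners are strictly increasing, hence distinct.
    chain-bound : ∀ {m F} → GreedyChain m F → suc m ≤ℕ k
    chain-bound {m} {F} chain = ℕ.≮⇒≥ not-k<sm
      where
      closes : ∀ i → i <ℕ m → ClosesAfter (F i) (F (suc i))
      closes i i<m = proj₁ (proj₂ chain i i<m)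

      corner : ∀ i → i ≤ℕ m → Fin k
      corner zero _ = i₀
      corner (suc i) si≤m = proj₁ (corner-inside (F (suc i)) (proj₂ (closes i si≤m)))

      F≺corner : ∀ i (si≤m : suc i ≤ℕ m) → pt (F i) ≺ σ (corner (suc i) si≤m)
      F≺corner i si≤m = ⊑-⊏-trans (proj₁ (closes i si≤m)) (proj₁ (proj₂ (corner-inside (F (suc i)) (proj₂ (closes i si≤m)))))

      corner≺F : ∀ i (si≤m : suc i ≤ℕ m) → σ (corner (suc i) si≤m) ≺ pt (F (suc i))
      corner≺F i si≤m = proj₂ (proj₂ (corner-inside (F (suc i)) (proj₂ (closes i si≤m))))

      corner-increasing : ∀ i j (i≤m : i ≤ℕ m) (j≤m : j ≤ℕ m) → i <ℕ j → σ (corner i i≤m) ≺ σ (corner j j≤m)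
      corner-increasing zero (suc j) _ sj≤m _ = subst (_≺ σ (corner (suc j) sj≤m)) (sym σ-x) (⊏-trans (x≺pt (F j)) (F≺corner j sj≤m))
      corner-increasing (suc i) (suc j) si≤m sj≤m (s≤s i<j) =
        ⊏-trans (corner≺F i si≤m) (⊑-⊏-trans (chain-≼ {F = F} chain i<j (ℕ.<⇒≤ sj≤m)) (F≺corner j sj≤m))

      corner′ : Fin (suc m) → Fin k
      corner′ i = corner (toℕ i) (ℕ.≤-pred (toℕ<n i))

      not-k<sm : ¬ (k <ℕ suc m)
      not-k<sm k<sm with pigeonhole k<sm corner′
      ... | i , j , i<j , same =
        ⊏-irrefl (subst (λ c → σ (corner′ i) ≺ σ c) (sym same) (corner-increasing (toℕ i) (toℕ j) _ _ i<j))

    maximal-exists : End → ∃ λ m → ∃ λ F → MaximalGreedyChain m F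
    maximal-exists e₀ with GreedyConstruction.greedy-chain-or-maximal e₀ k
    ... | inj₁ chain = ⊥-elim (ℕ.<-irrefl refl (chain-bound {F = GreedyConstruction.greedy e₀} chain))
    ... | inj₂ (m , maximal) = m , GreedyConstruction.greedy e₀ , maximal

    maximal-length : ∀ {m F} → MaximalGreedyChain m F → (∀ m′ → m′ <ℕ k → ¬ SatisfiedBy C m′) → suc m ≡ k
    maximal-length {m} {F} maximal minimal =
      ℕ.≤-antisym (chain-bound {F = F} (proj₁ maximal)) (ℕ.≮⇒≥ λ sm<k → minimal (suc m) sm<k (Maximal.τ-satisfiedBy {F = F} maximal))

    minimal-structure : End → (∀ m → m <ℕ k → ¬ SatisfiedBy C m) →
                        (∃ λ L → length L ≡ k ∸ 1 × IndepSeries C L) × Labelling C k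
    minimal-structure e₀ minimal with maximal-exists e₀
    ... | m , F , maximal with maximal-length {F = F} maximal minimal
    ... | refl = maximal-conclusion {F = F} maximal

theorem3 : ∀ {n} (C : CircleRep n) (k : ℕ) → PsiR C k → Psi C k →
    (∃ λ (L : List (Fin n)) → length L ≡ k ∸ 1 × IndepSeries C L)
    × (Σ (ℕ → Point) λ τ → GoodCorners C k τ
        × (Σ (ℕ → Fin n) λ c →
            (∀ i → i <ℕ k → CloseChord C k τ i (c i))
          × (∀ i → 1 ≤ℕ i → i <ℕ k → InCorner C k τ i (c i))
          × ((InCorner C k τ 0 (c 0) × IndepSeries C (map c (upTo k)))
            ⊎ (IndepSeries C (map (c ∘ suc) (upTo (k ∸ 1)))
              × (2 <ℕ k → ∀ v → InCorner C k τ 0 v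
                   → Cross C v (c 1) × ¬ Cross C v (c (k ∸ 1)))
              × (k ≡ 2 → Clique C)))))
theorem3 {zero} C (suc k) (_ , minimal) _ = ⊥-elim (minimal 0 (s≤s z≤n) no-corners-needed)
  where
  no-corners-needed : SatisfiedBy C 0
  no-corners-needed = (λ ()) , (λ { {()} }) , (λ ()) , (λ ())
theorem3 C zero _ (() , _)
theorem3 {suc n} C (suc k) ((σ , _ , σ-corner , σ-satisfies) , minimal) _ =
  BoundedBy.minimal-structure σ σ-satisfies zero refl (zero , true) minimal
  where open CutAt C (σ zero) (σ-corner zero)
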